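{- Let $k\ge1$ and let $F_n^K(\mathbf z;q)=\sum_{\pi\in RLP_n^K}\big(\prod_j z_{\ell_j}\big)q^{\mathrm{maj}(\pi)}$ as in the context. Then for all $m,n\ge1$, $$F_{m+n}^k(\mathbf z;q)=F_m^k(\mathbf z;q)F_n^k(E_m\mathbf z;q)+\sum_{i=2}^k\sum_{j=1}^{i-1}z_i\,q^{(m-j)(i-1)+\binom{i}{2}}F_{m-j}^k(\mathbf z;q)F_{n-i+j}^k(E_{m+i-j}\mathbf z;q);$$ for all $n\ge1$, $$F_n^k(\mathbf z;q)=F_n^{k-1}(\mathbf z;q)+\sum_{j=0}^{n-k}z_k\,q^{j(k-1)+\binom{k}{2}}F_j^{k-1}(\mathbf z;q)F_{n-k-j}^k(E_{k+j}\mathbf z;q);$$ and for all $n\ge1$, the $k\times k$ matrix $M$ with entries $M_{s,t}=F^k_{n+k-1+t-s}(E_{s-1}\mathbf z;q)$ ($1\le s,t\le k$) satisfies $$\det M=\begin{cases}z_k^{n+k-1}q^{(k-1)\binom{n+k-1}{2}+\binom{k}{2}(n+k-1)}&\text{if }k\text{ is odd},\\(-1)^{n-1}z_k^{n+k-1}q^{(k-1)\binom{n+k-1}{2}+\binom{k}{2}(n+k-1)}&\text{if }k\text{ is even}.\end{cases}$$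
   Context: For a composition $(\ell_1,\dots,\ell_r)$ of $n$, the reverse layered permutation of $[n]$ has first $\ell_1$ entries $1,\dots,\ell_1$ in decreasing order, next $\ell_2$ entries $\ell_1+1,\dots,\ell_1+\ell_2$ in decreasing order, etc.; these blocks are its layers. For $K\ge0$, $RLP_n^K$ is the set of reverse layered permutations of $[n]$ with all layers of length at most $K$. $\mathbf z=(z_1,\dots,z_k)$ are indeterminates; $F_n^K(\mathbf z;q)$ is a polynomial in them and $q$, and for an integer $m$, $F_n^K(E_m\mathbf z;q)$ denotes the substitution $z_i\mapsto z_iq^{(i-1)m}$ for all $i$. $\mathrm{maj}(\pi)$ is the sum of all $i$ with $\pi(i)>\pi(i+1)$. Conventions: $F_0^K=1$, $F_n^K=0$ for $n<0$. -}

module Defs where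

open import Level using (Level)
open import Algebra.Bundles using (CommutativeRing)
open import Data.Nat using (ℕ; zero; suc; _∸_; _<?_; _≤?_) renaming (_+_ to _+ℕ_; _*_ to _*ℕ_)
open import Data.Integer using (ℤ; +_; -[1+_])
open import Data.Fin using (Fin; toℕ; punchIn) renaming (zero to fzero; suc to fsuc)
open import Data.List using (List; []; _∷_; _++_; map; concatMap; filter; upTo; downFrom; foldr)
open import Data.Bool using (if_then_else_)
open import Relation.Nullary.Decidable using (⌊_⌋)

range : ℕ → ℕ → List ℕ
range a b = map (λ x → a +ℕ x) (upTo (suc b ∸ a))

-- compositions with parts in {1..K} of n, with fuel (fuel ≥ n suffices)
compsFuel : ℕ → ℕ → ℕ → List (List ℕ)
compsFuel K zero    zero    = [] ∷ []
compsFuel K zero    (suc _) = []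
compsFuel K (suc f) zero    = [] ∷ []
compsFuel K (suc f) (suc n) =
  concatMap (λ ℓ → map (ℓ ∷_) (compsFuel K f (suc n ∸ ℓ)))
            (filter (λ ℓ → ℓ ≤? suc n) (range 1 K))

compositions : ℕ → ℕ → List (List ℕ)
compositions K n = compsFuel K n n

-- the reverse layered permutation (one-line notation) with given layer
-- lengths; the first argument is the offset (number of entries before)
rlpFrom : ℕ → List ℕ → List ℕ
rlpFrom off []       = []
rlpFrom off (ℓ ∷ ls) = map (λ i → off +ℕ suc i) (downFrom ℓ) ++ rlpFrom (off +ℕ ℓ) ls

rlp : List ℕ → List ℕ
rlp = rlpFrom 0

-- major index of a word: sum of positions i (1-based) with w(i) > w(i+1)
majFrom : ℕ → List ℕ → ℕ
majFrom i []           = 0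
majFrom i (a ∷ [])     = 0
majFrom i (a ∷ b ∷ w)  = (if ⌊ b <? a ⌋ then i else 0) +ℕ majFrom (suc i) (b ∷ w)

maj : List ℕ → ℕ
maj = majFrom 1

module Poly {c ℓ : Level} (R : CommutativeRing c ℓ) where
  open CommutativeRing R

  pow : Carrier → ℕ → Carrier
  pow x zero    = 1#
  pow x (suc n) = x * pow x n

  sgn : ℕ → Carrier
  sgn zero    = 1#
  sgn (suc n) = - sgn n

  sumL : List ℕ → (ℕ → Carrier) → Carrier
  sumL xs f = foldr (λ x acc → f x + acc) 0# xs

  prodL : List ℕ → (ℕ → Carrier) → Carrier
  prodL xs f = foldr (λ x acc → f x * acc) 1# xs

  -- F_n^K(z;q) = Σ_{π ∈ RLP_n^K} (Π_j z_{ℓ_j}) q^{maj π};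
  -- z i stands for z_i (only indices 1..K are used)
  F : ℕ → ℕ → (ℕ → Carrier) → Carrier → Carrier
  F K n z q = foldr (λ ls acc → prodL ls z * pow q (maj (rlp ls)) + acc) 0# (compositions K n)

  Fℤ : ℕ → ℤ → (ℕ → Carrier) → Carrier → Carrier
  Fℤ K (+ n)      z q = F K n z q
  Fℤ K -[1+ _ ]   z q = 0#

  E : ℕ → Carrier → (ℕ → Carrier) → (ℕ → Carrier)
  E m q z i = z i * pow q ((i ∸ 1) *ℕ m)

  sumFin : ∀ n → (Fin n → Carrier) → Carrier
  sumFin zero    f = 0#
  sumFin (suc n) f = f fzero + sumFin n (λ i → f (fsuc i))

  det : ∀ n → (Fin n → Fin n → Carrier) → Carrier
  det zero    M = 1#
  det (suc n) M = sumFin (suc n) λ i →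
    sgn (toℕ i) * (M i fzero * det n (λ r c → M (punchIn i r) (fsuc c)))

module Submission where

-- A reverse layered permutation is a composition into layers;
-- its descents are exactly the internal positions of its layers, so a layer
-- of length ℓ occupying positions p+1, …, p+ℓ contributes (ℓ-1)p + C(ℓ,2)
-- to maj.  Hence the weight Π z_ℓ · q^maj is a product of layer weights, and
-- the substitution E_m shifts every layer by m positions: all F's in the
-- theorem are generating functions seg e s of compositions of a segment of
-- positions (s, e] placed where they stand.
--
-- The three
-- statements follow: the first is the cut identity at m, the second the
-- maximal-layer decomposition, and for the third the determinant
-- D(N) = det [seg (N+t) s] satisfies D(0) = 1 (it is unitriangular) and
-- D(N+1) = (-1)^{k-1} z_k q^{(k-1)N + C(k,2)} D(N), by expanding the new
-- column with the last-layer recursion: every last layer shorter than k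
-- reproduces an old column.

open import Level using (Level)
open import Algebra.Bundles using (CommutativeRing)
open import Data.Nat using (ℕ; zero; suc; _∸_; _≤_; _<_; z≤n; s≤s; _<?_; _≤?_; _/_) renaming (_+_ to _+ℕ_; _*_ to _*ℕ_)
import Data.Nat.Properties as NP
open import Data.Nat.Combinatorics using (_C_; nC1≡n; nCk+nC[k+1]≡[n+1]C[k+1])
open import Data.Nat.DivMod using (_%_; m≡m%n+[m/n]*n)
open import Data.Nat.Solver using (module +-*-Solver)
open import Data.Integer using (+_; _⊖_) renaming (_+_ to _+ℤ_; _-_ to _-ℤ_)
import Data.Integer.Properties as ZP
open import Data.Fin using (Fin; toℕ; punchIn; fromℕ<) renaming (zero to fzero; suc to fsuc)
open import Data.Fin.Properties using (toℕ-fromℕ<; toℕ<n)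
open import Data.List using (List; []; _∷_; _++_; map; downFrom; upTo; applyUpTo; concatMap; filter; foldr)
open import Data.List.Relation.Unary.All using (All; []; _∷_)
import Data.List.Relation.Unary.All as All
import Data.List.Relation.Unary.All.Properties as AllP
open import Data.Product using (_×_; _,_)
open import Data.Bool using (Bool; true; false; if_then_else_)
open import Data.Empty using (⊥-elim)
open import Relation.Nullary using (yes; no; does)
open import Relation.Nullary.Decidable using (isYes≗does; dec-true; dec-false)
open import Relation.Unary using (Pred; Decidable)
open import Relation.Binary.PropositionalEquality as P using (_≡_; _≢_)
open import Defs

if-true : ∀ {a} {X : Set a} {c : Bool} {u v : X} → c ≡ true → (if c then u else v) ≡ u
if-true P.refl = P.refl

if-false : ∀ {a} {X : Set a} {c : Bool} {u v : X} → c ≡ false → (if c then u else v) ≡ v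
if-false P.refl = P.refl

module ExponentArithmetic where
  open +-*-Solver

  -- Shifting a layer by m positions multiplies its weight by q^{(ℓ-1)m}.
  shift-exponent : ∀ L m p c → L *ℕ m +ℕ (L *ℕ p +ℕ c) ≡ L *ℕ (p +ℕ m) +ℕ c
  shift-exponent = solve 4 (λ L m p c → L :* m :+ (L :* p :+ c) := L :* (p :+ m) :+ c) P.refl

  suc-C2 : ∀ N → suc N C 2 ≡ N +ℕ N C 2
  suc-C2 N = P.trans (P.sym (nCk+nC[k+1]≡[n+1]C[k+1] N 1)) (P.cong (_+ℕ N C 2) (nC1≡n N))

  -- The determinant exponent at N+1 is the one at N plus the exponent
  -- (k-1)N + C(k,2) of a layer of length k after position N.
  det-exponent-step : ∀ K' N t →
    K' *ℕ (suc N C 2) +ℕ t *ℕ suc N ≡ (K' *ℕ N +ℕ t) +ℕ (K' *ℕ (N C 2) +ℕ t *ℕ N)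
  det-exponent-step K' N t = P.trans (P.cong (λ u → K' *ℕ u +ℕ t *ℕ suc N) (suc-C2 N)) (regroup K' N (N C 2) t)
    where
    regroup : ∀ k n c t → k *ℕ (n +ℕ c) +ℕ t *ℕ suc n ≡ (k *ℕ n +ℕ t) +ℕ (k *ℕ c +ℕ t *ℕ n)
    regroup = solve 4 (λ k n c t → k :* (n :+ c) :+ t :* (con 1 :+ n) := (k :* n :+ t) :+ (k :* c :+ t :* n)) P.refl

  -- (2h)N = 2(hN): an even multiple has sign 1.
  even-swap : ∀ h N → (h *ℕ 2) *ℕ N ≡ (h *ℕ N) *ℕ 2
  even-swap = solve 2 (λ h N → (h :* con 2) :* N := (h :* N) :* con 2) P.refl

layer : ℕ → ℕ → List ℕ
layer ℓ p = map (λ i → p +ℕ suc i) (downFrom ℓ)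

-- Sum of the descent positions i, i+1, …, i+ℓ-2 inside a decreasing run of
-- length ℓ starting at position i.
descentSum : ℕ → ℕ → ℕ
descentSum i zero = 0
descentSum i (suc zero) = 0
descentSum i (suc (suc ℓ)) = i +ℕ descentSum (suc i) (suc ℓ)

-- A layer followed by larger letters contributes exactly its internal
-- descents to the major index: there is no descent at its right end.
majFrom-layer-++ : ∀ ℓ i p w → All (λ x → suc p < x) w →
  majFrom i (layer ℓ p ++ w) ≡ descentSum i ℓ +ℕ majFrom (i +ℕ ℓ) w
majFrom-layer-++ zero i p w _ = P.cong (λ t → majFrom t w) (P.sym (NP.+-identityʳ i))
majFrom-layer-++ (suc zero) i p [] _ = P.refl
majFrom-layer-++ (suc zero) i p (x ∷ w) (p+1<x ∷ _) = P.trans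
  (P.cong (_+ℕ majFrom (suc i) (x ∷ w)) (if-false (P.trans (isYes≗does (x <? p +ℕ 1)) (dec-false (x <? p +ℕ 1) (λ x<p+1 → NP.<-asym x<p+1 p+1<x')))))
  (P.cong (λ t → majFrom t (x ∷ w)) (P.sym (NP.+-comm i 1)))
  where p+1<x' : p +ℕ 1 < x
        p+1<x' = P.subst (_< x) (NP.+-comm 1 p) p+1<x
majFrom-layer-++ (suc (suc ℓ)) i p w above = P.trans
  (P.cong (_+ℕ majFrom (suc i) (layer (suc ℓ) p ++ w)) (if-true (P.trans (isYes≗does d) (dec-true d (NP.+-monoʳ-< p (NP.n<1+n (suc ℓ)))))))
  (P.trans (P.cong (i +ℕ_) (P.trans (majFrom-layer-++ (suc ℓ) (suc i) p w above)
                                    (P.cong (λ t → descentSum (suc i) (suc ℓ) +ℕ majFrom t w) (P.sym (NP.+-suc i (suc ℓ))))))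
           (P.sym (NP.+-assoc i _ _)))
  where d = p +ℕ suc ℓ <? p +ℕ suc (suc ℓ)

descentSum-closed : ∀ ℓ i → descentSum i (suc ℓ) ≡ ℓ *ℕ i +ℕ ℓ C 2
descentSum-closed zero i = P.refl
descentSum-closed (suc ℓ) i = begin
    i +ℕ descentSum (suc i) (suc ℓ)
  ≡⟨ P.cong (i +ℕ_) (descentSum-closed ℓ (suc i)) ⟩
    i +ℕ (ℓ *ℕ suc i +ℕ ℓ C 2)
  ≡⟨ P.cong (λ t → i +ℕ (t +ℕ ℓ C 2)) (NP.*-suc ℓ i) ⟩
    i +ℕ ((ℓ +ℕ ℓ *ℕ i) +ℕ ℓ C 2)
  ≡⟨ regroup i ℓ (ℓ *ℕ i) (ℓ C 2) ⟩
    (i +ℕ ℓ *ℕ i) +ℕ (ℓ +ℕ ℓ C 2)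
  ≡⟨ P.cong ((i +ℕ ℓ *ℕ i) +ℕ_) (P.sym (ExponentArithmetic.suc-C2 ℓ)) ⟩
    suc ℓ *ℕ i +ℕ suc ℓ C 2 ∎
  where
  open P.≡-Reasoning
  open +-*-Solver
  regroup : ∀ a b c d → a +ℕ ((b +ℕ c) +ℕ d) ≡ (a +ℕ c) +ℕ (b +ℕ d)
  regroup = solve 4 (λ a b c d → a :+ ((b :+ c) :+ d) := (a :+ c) :+ (b :+ d)) P.refl

layerMaj : ∀ ℓ p → descentSum (suc p) ℓ ≡ (ℓ ∸ 1) *ℕ p +ℕ ℓ C 2
layerMaj zero p = P.refl
layerMaj (suc ℓ) p = begin
    descentSum (suc p) (suc ℓ)
  ≡⟨ descentSum-closed ℓ (suc p) ⟩
    ℓ *ℕ suc p +ℕ ℓ C 2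
  ≡⟨ P.cong (_+ℕ ℓ C 2) (NP.*-suc ℓ p) ⟩
    (ℓ +ℕ ℓ *ℕ p) +ℕ ℓ C 2
  ≡⟨ regroup ℓ (ℓ *ℕ p) (ℓ C 2) ⟩
    ℓ *ℕ p +ℕ (ℓ +ℕ ℓ C 2)
  ≡⟨ P.cong (ℓ *ℕ p +ℕ_) (P.sym (ExponentArithmetic.suc-C2 ℓ)) ⟩
    ℓ *ℕ p +ℕ suc ℓ C 2 ∎
  where
  open P.≡-Reasoning
  open +-*-Solver
  regroup : ∀ a b c → (a +ℕ b) +ℕ c ≡ b +ℕ (a +ℕ c)
  regroup = solve 3 (λ a b c → (a :+ b) :+ c := b :+ (a :+ c)) P.refl

rlpFrom-above : ∀ p ls → All (p <_) (rlpFrom p ls)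
rlpFrom-above p [] = []
rlpFrom-above p (ℓ ∷ ls) =
  AllP.++⁺ (layer-above ℓ) (All.map (NP.≤-trans (s≤s (NP.m≤m+n p ℓ))) (rlpFrom-above (p +ℕ ℓ) ls))
  where
  layer-above : ∀ ℓ → All (p <_) (layer ℓ p)
  layer-above zero = []
  layer-above (suc ℓ) = P.subst (p <_) (P.sym (NP.+-suc p ℓ)) (s≤s (NP.m≤m+n p ℓ)) ∷ layer-above ℓ

majFrom-rlp-∷ : ∀ ℓ i p ls →
  majFrom i (rlpFrom p (ℓ ∷ ls)) ≡ descentSum i ℓ +ℕ majFrom (i +ℕ ℓ) (rlpFrom (p +ℕ ℓ) ls)
majFrom-rlp-∷ zero i p ls = P.cong (λ t → majFrom t (rlpFrom (p +ℕ 0) ls)) (P.sym (NP.+-identityʳ i))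
majFrom-rlp-∷ (suc ℓ) i p ls = majFrom-layer-++ (suc ℓ) i p (rlpFrom (p +ℕ suc ℓ) ls)
  (All.map (λ {x} p+ℓ+1<x → NP.≤-trans (s≤s (s≤s (NP.m≤m+n p ℓ))) (P.subst (_< x) (NP.+-suc p ℓ) p+ℓ+1<x))
           (rlpFrom-above (p +ℕ suc ℓ) ls))

module WithRing {c₀ ℓ₀ : Level} (R : CommutativeRing c₀ ℓ₀) where
  open CommutativeRing R
  open Poly R
  open import Relation.Binary.Reasoning.Setoid setoid
  open import Algebra.Solver.Ring.NaturalCoefficients.Default commutativeSemiring
  open import Algebra.Properties.Ring ring using (-‿distribˡ-*; -‿distribʳ-*; -‿involutive; -0#≈0#; -1*x≈-x)
  open import Algebra.Properties.AbelianGroup +-abelianGroup using (⁻¹-∙-comm)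
  open import Algebra.Properties.Group +-group using (inverseʳ-unique)

  pow-+ : ∀ x a b → pow x (a +ℕ b) ≈ pow x a * pow x b
  pow-+ x zero b = sym (*-identityˡ _)
  pow-+ x (suc a) b = trans (*-cong refl (pow-+ x a b)) (sym (*-assoc _ _ _))

  pow-cong : ∀ x {a b} → a ≡ b → pow x a ≈ pow x b
  pow-cong x e = reflexive (P.cong (pow x) e)

  sgn-+ : ∀ a b → sgn (a +ℕ b) ≈ sgn a * sgn b
  sgn-+ zero b = sym (*-identityˡ _)
  sgn-+ (suc a) b = trans (-‿cong (sgn-+ a b)) (-‿distribˡ-* (sgn a) (sgn b))

  sgn-even : ∀ h → sgn (h *ℕ 2) ≈ 1#
  sgn-even zero = refl
  sgn-even (suc h) = trans (-‿involutive _) (sgn-even h)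

  Σl : ∀ {a} {A : Set a} → List A → (A → Carrier) → Carrier
  Σl xs f = foldr (λ x acc → f x + acc) 0# xs

  Σl-cong : ∀ {a} {A : Set a} (xs : List A) {f g : A → Carrier} → (∀ x → f x ≈ g x) → Σl xs f ≈ Σl xs g
  Σl-cong [] f≈g = refl
  Σl-cong (x ∷ xs) f≈g = +-cong (f≈g x) (Σl-cong xs f≈g)

  Σl-++ : ∀ {a} {A : Set a} (xs ys : List A) (f : A → Carrier) → Σl (xs ++ ys) f ≈ Σl xs f + Σl ys f
  Σl-++ [] ys f = sym (+-identityˡ _)
  Σl-++ (x ∷ xs) ys f = trans (+-cong refl (Σl-++ xs ys f)) (sym (+-assoc _ _ _))

  Σl-map : ∀ {a b} {A : Set a} {B : Set b} (g : A → B) (xs : List A) (f : B → Carrier) →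
    Σl (map g xs) f ≡ Σl xs (λ x → f (g x))
  Σl-map g [] f = P.refl
  Σl-map g (x ∷ xs) f = P.cong (λ t → f (g x) + t) (Σl-map g xs f)

  Σl-concatMap : ∀ {a b} {A : Set a} {B : Set b} (g : A → List B) (xs : List A) (f : B → Carrier) →
    Σl (concatMap g xs) f ≈ Σl xs (λ x → Σl (g x) f)
  Σl-concatMap g [] f = refl
  Σl-concatMap g (x ∷ xs) f = trans (Σl-++ (g x) _ f) (+-cong refl (Σl-concatMap g xs f))

  Σl-filter : ∀ {a p} {A : Set a} {Q : Pred A p} (Q? : Decidable Q) (xs : List A) (f : A → Carrier) →
    Σl (filter Q? xs) f ≈ Σl xs (λ x → if does (Q? x) then f x else 0#)
  Σl-filter Q? [] f = refl
  Σl-filter Q? (x ∷ xs) f with does (Q? x)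
  ... | true = +-cong refl (Σl-filter Q? xs f)
  ... | false = trans (Σl-filter Q? xs f) (sym (+-identityˡ _))

  Σl-*ˡ : ∀ {a} {A : Set a} (xs : List A) (u : Carrier) (f : A → Carrier) → u * Σl xs f ≈ Σl xs (λ x → u * f x)
  Σl-*ˡ [] u f = zeroʳ u
  Σl-*ˡ (x ∷ xs) u f = trans (distribˡ u _ _) (+-cong refl (Σl-*ˡ xs u f))

  Σ< : ℕ → (ℕ → Carrier) → Carrier
  Σ< zero f = 0#
  Σ< (suc n) f = f 0 + Σ< n (λ i → f (suc i))

  Σl-applyUpTo : ∀ (g : ℕ → ℕ) n (f : ℕ → Carrier) → Σl (applyUpTo g n) f ≡ Σ< n (λ i → f (g i))
  Σl-applyUpTo g zero f = P.refl
  Σl-applyUpTo g (suc n) f = P.cong (λ t → f (g 0) + t) (Σl-applyUpTo (λ i → g (suc i)) n f)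

  Σ<-cong-below : ∀ n {f g : ℕ → Carrier} → (∀ i → i < n → f i ≈ g i) → Σ< n f ≈ Σ< n g
  Σ<-cong-below zero f≈g = refl
  Σ<-cong-below (suc n) f≈g = +-cong (f≈g 0 (s≤s z≤n)) (Σ<-cong-below n (λ i i<n → f≈g (suc i) (s≤s i<n)))

  Σ<-cong : ∀ n {f g : ℕ → Carrier} → (∀ i → f i ≈ g i) → Σ< n f ≈ Σ< n g
  Σ<-cong n f≈g = Σ<-cong-below n (λ i _ → f≈g i)

  Σ<-zero : ∀ n {f : ℕ → Carrier} → (∀ i → i < n → f i ≈ 0#) → Σ< n f ≈ 0#
  Σ<-zero zero f≈0 = refl
  Σ<-zero (suc n) f≈0 = trans (+-cong (f≈0 0 (s≤s z≤n)) (Σ<-zero n (λ i i<n → f≈0 (suc i) (s≤s i<n)))) (+-identityˡ _)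

  Σ<-truncate : ∀ N A (f : ℕ → Carrier) → A ≤ N → (∀ i → A ≤ i → i < N → f i ≈ 0#) → Σ< N f ≈ Σ< A f
  Σ<-truncate N zero f _ f≈0 = Σ<-zero N (λ i i<N → f≈0 i z≤n i<N)
  Σ<-truncate (suc N) (suc A) f (s≤s A≤N) f≈0 =
    +-cong refl (Σ<-truncate N A (λ i → f (suc i)) A≤N (λ i A≤i i<N → f≈0 (suc i) (s≤s A≤i) (s≤s i<N)))

  Σ<-+ : ∀ n (f g : ℕ → Carrier) → Σ< n (λ i → f i + g i) ≈ Σ< n f + Σ< n g
  Σ<-+ zero f g = sym (+-identityˡ _)
  Σ<-+ (suc n) f g = trans (+-cong refl (Σ<-+ n _ _)) (interchange _ _ _ _)
    where interchange : ∀ a b c d → (a + b) + (c + d) ≈ (a + c) + (b + d)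
          interchange = solve 4 (λ a b c d → (a :+ b) :+ (c :+ d) := (a :+ c) :+ (b :+ d)) refl

  Σ<-*ˡ : ∀ n (u : Carrier) (f : ℕ → Carrier) → u * Σ< n f ≈ Σ< n (λ i → u * f i)
  Σ<-*ˡ zero u f = zeroʳ u
  Σ<-*ˡ (suc n) u f = trans (distribˡ u _ _) (+-cong refl (Σ<-*ˡ n u _))

  Σ<-*ʳ : ∀ n (u : Carrier) (f : ℕ → Carrier) → Σ< n f * u ≈ Σ< n (λ i → f i * u)
  Σ<-*ʳ n u f = trans (*-comm _ _) (trans (Σ<-*ˡ n u f) (Σ<-cong n (λ i → *-comm _ _)))

  Σ<-swap : ∀ a b (f : ℕ → ℕ → Carrier) → Σ< a (λ i → Σ< b (λ j → f i j)) ≈ Σ< b (λ j → Σ< a (λ i → f i j))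
  Σ<-swap zero b f = sym (Σ<-zero b (λ _ _ → refl))
  Σ<-swap (suc a) b f = trans (+-cong refl (Σ<-swap a b _)) (sym (Σ<-+ b _ _))

  Σ<-last : ∀ n (f : ℕ → Carrier) → Σ< (suc n) f ≈ Σ< n f + f n
  Σ<-last zero f = +-comm _ _
  Σ<-last (suc n) f = trans (+-cong refl (Σ<-last n _)) (sym (+-assoc _ _ _))

  δ : ℕ → ℕ → Carrier
  δ zero zero = 1#
  δ zero (suc _) = 0#
  δ (suc _) zero = 0#
  δ (suc a) (suc b) = δ a b

  δ-≢ : ∀ a b → a ≢ b → δ a b ≈ 0#
  δ-≢ zero zero a≢b = ⊥-elim (a≢b P.refl)
  δ-≢ zero (suc b) a≢b = refl
  δ-≢ (suc a) zero a≢b = refl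
  δ-≢ (suc a) (suc b) a≢b = δ-≢ a b (λ e → a≢b (P.cong suc e))

  δ-shift : ∀ s a b → δ (s +ℕ a) (b +ℕ s) ≡ δ a b
  δ-shift s a b = P.trans (P.cong (δ (s +ℕ a)) (NP.+-comm b s)) (cancel s)
    where cancel : ∀ s → δ (s +ℕ a) (s +ℕ b) ≡ δ a b
          cancel zero = P.refl
          cancel (suc s) = cancel s

  Σ<-δ : ∀ n c (f : ℕ → Carrier) → c < n → Σ< n (λ j → δ c j * f j) ≈ f c
  Σ<-δ (suc n) zero f _ = trans (+-cong (*-identityˡ _) (Σ<-zero n (λ i _ → zeroˡ _))) (+-identityʳ _)
  Σ<-δ (suc n) (suc c) f (s≤s c<n) = trans (+-cong (zeroˡ _) (Σ<-δ n c (λ j → f (suc j)) c<n)) (+-identityˡ _)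

  Σ<-δ-outside : ∀ n c (f : ℕ → Carrier) → n ≤ c → Σ< n (λ j → δ c j * f j) ≈ 0#
  Σ<-δ-outside zero c f _ = refl
  Σ<-δ-outside (suc n) (suc c) f (s≤s n≤c) = trans (+-cong (zeroˡ _) (Σ<-δ-outside n c (λ j → f (suc j)) n≤c)) (+-identityˡ _)

  sumFin-cong : ∀ n {f g : Fin n → Carrier} → (∀ i → f i ≈ g i) → sumFin n f ≈ sumFin n g
  sumFin-cong zero f≈g = refl
  sumFin-cong (suc n) f≈g = +-cong (f≈g fzero) (sumFin-cong n (λ i → f≈g (fsuc i)))

  sumFin-zero : ∀ n (f : Fin n → Carrier) → (∀ i → f i ≈ 0#) → sumFin n f ≈ 0#
  sumFin-zero zero f f≈0 = refl
  sumFin-zero (suc n) f f≈0 = trans (+-cong (f≈0 fzero) (sumFin-zero n _ (λ i → f≈0 (fsuc i)))) (+-identityˡ _)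

  sumFin-+ : ∀ n (f g : Fin n → Carrier) → sumFin n (λ i → f i + g i) ≈ sumFin n f + sumFin n g
  sumFin-+ zero f g = sym (+-identityˡ _)
  sumFin-+ (suc n) f g = trans (+-cong refl (sumFin-+ n (λ i → f (fsuc i)) (λ i → g (fsuc i)))) (interchange _ _ _ _)
    where interchange : ∀ a b c d → (a + b) + (c + d) ≈ (a + c) + (b + d)
          interchange = solve 4 (λ a b c d → (a :+ b) :+ (c :+ d) := (a :+ c) :+ (b :+ d)) refl

  sumFin-*ˡ : ∀ n (u : Carrier) (f : Fin n → Carrier) → u * sumFin n f ≈ sumFin n (λ i → u * f i)
  sumFin-*ˡ zero u f = zeroʳ u
  sumFin-*ˡ (suc n) u f = trans (distribˡ u _ _) (+-cong refl (sumFin-*ˡ n u (λ i → f (fsuc i))))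

  sumFin-neg : ∀ n (f : Fin n → Carrier) → sumFin n (λ i → - f i) ≈ - sumFin n f
  sumFin-neg zero f = sym -0#≈0#
  sumFin-neg (suc n) f = trans (+-cong refl (sumFin-neg n (λ i → f (fsuc i)))) (⁻¹-∙-comm _ _)

  sumFin-Σ< : ∀ n K (f : Fin n → ℕ → Carrier) → sumFin n (λ i → Σ< K (f i)) ≈ Σ< K (λ l → sumFin n (λ i → f i l))
  sumFin-Σ< zero K f = sym (Σ<-zero K (λ _ _ → refl))
  sumFin-Σ< (suc n) K f = trans (+-cong refl (sumFin-Σ< n K (λ i → f (fsuc i)))) (sym (Σ<-+ K (f fzero) (λ l → sumFin n (λ i → f (fsuc i) l))))

  det-cong : ∀ n {M N : Fin n → Fin n → Carrier} → (∀ r c → M r c ≈ N r c) → det n M ≈ det n N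
  det-cong zero M≈N = refl
  det-cong (suc n) M≈N = sumFin-cong (suc n) (λ i → *-cong (refl {sgn (toℕ i)})
    (*-cong (M≈N i fzero) (det-cong n (λ r c → M≈N (punchIn i r) (fsuc c)))))

  minor : ∀ {n} → (Fin (suc n) → Fin (suc n) → Carrier) → Fin (suc n) → Fin n → Fin n → Carrier
  minor M i r c = M (punchIn i r) (fsuc c)

  cofactorTerm : ∀ {n} → (Fin (suc n) → Fin (suc n) → Carrier) → Fin (suc n) → Carrier
  cofactorTerm {n} M i = sgn (toℕ i) * (M i fzero * det n (minor M i))

  cons : ∀ {a} {A : Set a} {n} → A → (Fin n → A) → Fin (suc n) → A
  cons x σ fzero = x
  cons x σ (fsuc j) = σ j

  -- Expansion along the first two columns at once, abstracted over the
  -- product h ρᵢ ρⱼ of the two entries used and the complementary minor D,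
  -- for rows indexed by ρ.
  module Expand2 {a} {A : Set a} (h : A → A → Carrier) where
    Ext : ∀ n → ((Fin n → A) → Carrier) → Set _
    Ext n D = ∀ σ σ' → (∀ x → σ x ≡ σ' x) → D σ ≈ D σ'

    expand2 : ∀ n → ((Fin n → A) → Carrier) → (Fin (suc (suc n)) → A) → Carrier
    expand2 n D ρ = sumFin (suc (suc n)) (λ i → sgn (toℕ i) * sumFin (suc n) (λ r → sgn (toℕ r) *
                      (h (ρ i) (ρ (punchIn i r)) * D (λ x → ρ (punchIn i (punchIn r x))))))

    pairsFirstLeft : ∀ n → ((Fin (suc n) → A) → Carrier) → (Fin (suc (suc (suc n))) → A) → Carrier
    pairsFirstLeft n D ρ = sumFin (suc (suc n)) (λ r → sgn (toℕ r) * (h (ρ fzero) (ρ (fsuc r)) * D (λ x → ρ (fsuc (punchIn r x)))))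

    pairsFirstRight : ∀ n → ((Fin (suc n) → A) → Carrier) → (Fin (suc (suc (suc n))) → A) → Carrier
    pairsFirstRight n D ρ = sumFin (suc (suc n)) (λ i → sgn (toℕ i) * (h (ρ (fsuc i)) (ρ fzero) * D (λ x → ρ (fsuc (punchIn i x)))))

    -- The terms avoiding the first row form the same expansion one size down,
    -- the first row having moved into the minors.
    expand2-first-row : ∀ n D ρ → Ext (suc n) D →
      expand2 (suc n) D ρ ≈ pairsFirstLeft n D ρ + (- pairsFirstRight n D ρ + expand2 n (λ σ → D (cons (ρ fzero) σ)) (λ j → ρ (fsuc j)))
    expand2-first-row n D ρ ext = +-cong (*-identityˡ _) (begin
        sumFin (suc (suc n)) (λ i → - sgn (toℕ i) * (1# * X i + sumFin (suc n) (λ r → - sgn (toℕ r) * Y i r)))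
      ≈⟨ sumFin-cong (suc (suc n)) step ⟩
        sumFin (suc (suc n)) (λ i → - (sgn (toℕ i) * X i) + sgn (toℕ i) * sumFin (suc n) (λ r → sgn (toℕ r) * Y' i r))
      ≈⟨ sumFin-+ (suc (suc n)) (λ i → - (sgn (toℕ i) * X i)) (λ i → sgn (toℕ i) * sumFin (suc n) (λ r → sgn (toℕ r) * Y' i r)) ⟩
        sumFin (suc (suc n)) (λ i → - (sgn (toℕ i) * X i)) + expand2 n D' (λ j → ρ (fsuc j))
      ≈⟨ +-cong (sumFin-neg (suc (suc n)) (λ i → sgn (toℕ i) * X i)) refl ⟩
        - pairsFirstRight n D ρ + expand2 n D' (λ j → ρ (fsuc j)) ∎)
      where
      D' = λ σ → D (cons (ρ fzero) σ)
      X : Fin (suc (suc n)) → Carrier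
      X i = h (ρ (fsuc i)) (ρ fzero) * D (λ x → ρ (fsuc (punchIn i x)))
      Y : Fin (suc (suc n)) → Fin (suc n) → Carrier
      Y i r = h (ρ (fsuc i)) (ρ (fsuc (punchIn i r))) * D (λ x → ρ (punchIn (fsuc i) (punchIn (fsuc r) x)))
      Y' : Fin (suc (suc n)) → Fin (suc n) → Carrier
      Y' i r = h (ρ (fsuc i)) (ρ (fsuc (punchIn i r))) * D' (λ x → ρ (fsuc (punchIn i (punchIn r x))))
      Y≈Y' : ∀ i r → Y i r ≈ Y' i r
      Y≈Y' i r = *-cong refl (ext _ _ rows)
        where rows : ∀ x → ρ (punchIn (fsuc i) (punchIn (fsuc r) x)) ≡ cons (ρ fzero) (λ x → ρ (fsuc (punchIn i (punchIn r x)))) x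
              rows fzero = P.refl
              rows (fsuc x) = P.refl
      step : ∀ i → - sgn (toℕ i) * (1# * X i + sumFin (suc n) (λ r → - sgn (toℕ r) * Y i r))
                   ≈ - (sgn (toℕ i) * X i) + sgn (toℕ i) * sumFin (suc n) (λ r → sgn (toℕ r) * Y' i r)
      step i = begin
          - s * (1# * X i + sumFin (suc n) (λ r → - sgn (toℕ r) * Y i r))
        ≈⟨ *-cong refl (+-cong (*-identityˡ _) (trans (sumFin-cong (suc n) (λ r → trans (sym (-‿distribˡ-* (sgn (toℕ r)) (Y i r)))
                                                                                           (-‿cong (*-cong (refl {sgn (toℕ r)}) (Y≈Y' i r)))))
                                                     (sumFin-neg (suc n) (λ r → sgn (toℕ r) * Y' i r)))) ⟩
          - s * (X i + - Z)
        ≈⟨ distribˡ (- s) (X i) (- Z) ⟩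
          - s * X i + - s * - Z
        ≈⟨ +-cong (sym (-‿distribˡ-* s (X i))) (trans (sym (-‿distribˡ-* s (- Z))) (trans (-‿cong (sym (-‿distribʳ-* s Z))) (-‿involutive _))) ⟩
          - (s * X i) + s * Z ∎
        where s = sgn (toℕ i)
              Z = sumFin (suc n) (λ r → sgn (toℕ r) * Y' i r)

    expand2-base : ∀ D ρ → Ext 0 D → expand2 0 D ρ ≈ h (ρ fzero) (ρ (fsuc fzero)) * D (λ ()) + - (h (ρ (fsuc fzero)) (ρ fzero) * D (λ ()))
    expand2-base D ρ ext = +-cong (trans (*-identityˡ _) (trans (+-identityʳ _) (trans (*-identityˡ _) (*-cong refl (ext _ _ (λ ()))))))
      (trans (+-identityʳ _) (trans (-1*x≈-x _) (-‿cong (trans (+-identityʳ _) (trans (*-identityˡ _) (*-cong refl (ext _ _ (λ ()))))))))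

  Ext-cons : ∀ {a} {A : Set a} (h : A → A → Carrier) n (D : (Fin (suc n) → A) → Carrier) (x : A) →
    Expand2.Ext h (suc n) D → Expand2.Ext h n (λ σ → D (cons x σ))
  Ext-cons h n D x ext σ σ' σ≡σ' = ext _ _ (λ { fzero → P.refl ; (fsuc y) → σ≡σ' y })

  pairs-transpose : ∀ {a} {A : Set a} (h h' : A → A → Carrier) → (∀ x y → h' x y ≈ h y x) → ∀ n D ρ →
    Expand2.pairsFirstLeft h' n D ρ ≈ Expand2.pairsFirstRight h n D ρ
  pairs-transpose h h' h'≈h n D ρ = sumFin-cong (suc (suc n))
    {λ r → sgn (toℕ r) * (h' (ρ fzero) (ρ (fsuc r)) * D (λ x → ρ (fsuc (punchIn r x))))}
    {λ r → sgn (toℕ r) * (h (ρ (fsuc r)) (ρ fzero) * D (λ x → ρ (fsuc (punchIn r x))))}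
    (λ r → *-cong refl (*-cong (h'≈h _ _) refl))

  -- A symmetric h gives a vanishing expansion (two equal columns).
  expand2-symmetric : ∀ {a} {A : Set a} (h : A → A → Carrier) → (∀ x y → h x y ≈ h y x) →
    ∀ n D ρ → Expand2.Ext h n D → Expand2.expand2 h n D ρ ≈ 0#
  expand2-symmetric h h-sym zero D ρ ext =
    trans (expand2-base D ρ ext) (trans (+-cong (*-cong (h-sym _ _) refl) refl) (-‿inverseʳ _))
    where open Expand2 h
  expand2-symmetric h h-sym (suc n) D ρ ext = begin
      expand2 (suc n) D ρ
    ≈⟨ expand2-first-row n D ρ ext ⟩
      pairsFirstLeft n D ρ + (- pairsFirstRight n D ρ + expand2 n D' (λ j → ρ (fsuc j)))
    ≈⟨ +-cong (pairs-transpose h h (λ x y → h-sym x y) n D ρ) refl ⟩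
      pairsFirstRight n D ρ + (- pairsFirstRight n D ρ + expand2 n D' (λ j → ρ (fsuc j)))
    ≈⟨ trans (sym (+-assoc _ _ _)) (trans (+-cong (-‿inverseʳ _) refl) (+-identityˡ _)) ⟩
      expand2 n D' (λ j → ρ (fsuc j))
    ≈⟨ expand2-symmetric h h-sym n D' (λ j → ρ (fsuc j)) (Ext-cons h n D (ρ fzero) ext) ⟩
      0# ∎
    where open Expand2 h
          D' = λ σ → D (cons (ρ fzero) σ)

  expand2-antisymmetric : ∀ {a} {A : Set a} (h h' : A → A → Carrier) → (∀ x y → h' x y ≈ h y x) →
    ∀ n D ρ → Expand2.Ext h n D → Expand2.expand2 h n D ρ + Expand2.expand2 h' n D ρ ≈ 0#
  expand2-antisymmetric h h' h'≈h zero D ρ ext =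
    trans (+-cong (expand2-base h D ρ ext) (expand2-base h' D ρ ext))
          (trans (+-cong refl (+-cong (*-cong (h'≈h _ _) refl) (-‿cong (*-cong (h'≈h _ _) refl)))) (cancel _ _))
    where
    open Expand2
    cancel : ∀ x y → (x + - y) + (y + - x) ≈ 0#
    cancel x y = trans (regroup x (- y) y (- x)) (trans (+-cong (-‿inverseʳ x) (-‿inverseʳ y)) (+-identityˡ _))
      where regroup : ∀ x ny y nx → (x + ny) + (y + nx) ≈ (x + nx) + (y + ny)
            regroup = solve 4 (λ x ny y nx → (x :+ ny) :+ (y :+ nx) := (x :+ nx) :+ (y :+ ny)) refl
  expand2-antisymmetric h h' h'≈h (suc n) D ρ ext = begin
      E₁.expand2 (suc n) D ρ + E₂.expand2 (suc n) D ρ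
    ≈⟨ +-cong (E₁.expand2-first-row n D ρ ext) (E₂.expand2-first-row n D ρ ext) ⟩
      (E₁.pairsFirstLeft n D ρ + (- E₁.pairsFirstRight n D ρ + E₁.expand2 n D' ρ'))
        + (E₂.pairsFirstLeft n D ρ + (- E₂.pairsFirstRight n D ρ + E₂.expand2 n D' ρ'))
    ≈⟨ +-cong refl (+-cong (pairs-transpose h h' h'≈h n D ρ) (+-cong (-‿cong (sym (pairs-transpose h' h (λ x y → sym (h'≈h y x)) n D ρ))) refl)) ⟩
      (E₁.pairsFirstLeft n D ρ + (- E₁.pairsFirstRight n D ρ + E₁.expand2 n D' ρ'))
        + (E₁.pairsFirstRight n D ρ + (- E₁.pairsFirstLeft n D ρ + E₂.expand2 n D' ρ'))
    ≈⟨ cancel-pairs _ _ _ _ ⟩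
      E₁.expand2 n D' ρ' + E₂.expand2 n D' ρ'
    ≈⟨ expand2-antisymmetric h h' h'≈h n D' ρ' (Ext-cons h n D (ρ fzero) ext) ⟩
      0# ∎
    where
    module E₁ = Expand2 h
    module E₂ = Expand2 h'
    D' = λ σ → D (cons (ρ fzero) σ)
    ρ' = λ j → ρ (fsuc j)
    cancel-pairs : ∀ a b s t → (a + (- b + s)) + (b + (- a + t)) ≈ s + t
    cancel-pairs a b s t = trans (regroup a (- b) s b (- a) t)
      (trans (+-cong (-‿inverseʳ a) (+-cong (-‿inverseʳ b) refl)) (trans (+-identityˡ _) (+-identityˡ _)))
      where regroup : ∀ a nb s b na t → (a + (nb + s)) + (b + (na + t)) ≈ (a + na) + ((b + nb) + (s + t))
            regroup = solve 6 (λ a nb s b na t → (a :+ (nb :+ s)) :+ (b :+ (na :+ t)) := (a :+ na) :+ ((b :+ nb) :+ (s :+ t))) refl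

  det-expand2 : ∀ n (M : Fin (suc (suc n)) → Fin (suc (suc n)) → Carrier) →
    det (suc (suc n)) M ≈ Expand2.expand2 (λ a b → M a fzero * M b (fsuc fzero)) n (λ σ → det n (λ r c → M (σ r) (fsuc (fsuc c)))) (λ i → i)
  det-expand2 n M = sumFin-cong (suc (suc n)) {cofactorTerm M} {λ i → sgn (toℕ i) * sumFin (suc n) (pairTerm i)}
    (λ i → *-cong refl (trans (sumFin-*ˡ (suc n) (M i fzero) (cofactorTerm (minor M i)))
                              (sumFin-cong (suc n) {λ r → M i fzero * cofactorTerm (minor M i) r} {pairTerm i}
                                           (λ r → regroup (M i fzero) (sgn (toℕ r)) (M (punchIn i r) (fsuc fzero)) _))))
    where
    pairTerm : Fin (suc (suc n)) → Fin (suc n) → Carrier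
    pairTerm i r = sgn (toℕ r) * ((M i fzero * M (punchIn i r) (fsuc fzero)) * det n (λ r' c → M (punchIn i (punchIn r r')) (fsuc (fsuc c))))
    regroup : ∀ u s m d → u * (s * (m * d)) ≈ s * ((u * m) * d)
    regroup = solve 4 (λ u s m d → u :* (s :* (m :* d)) := s :* ((u :* m) :* d)) refl

  minor2-ext : ∀ n (M : Fin (suc (suc n)) → Fin (suc (suc n)) → Carrier) →
    Expand2.Ext (λ (a b : Fin (suc (suc n))) → M a fzero * M b (fsuc fzero)) n (λ σ → det n (λ r c → M (σ r) (fsuc (fsuc c))))
  minor2-ext n M σ σ' σ≡σ' = det-cong n (λ r c → reflexive (P.cong (λ t → M t (fsuc (fsuc c))) (σ≡σ' r)))

  swapAdj : ∀ {n} → Fin n → Fin (suc n) → Fin (suc n)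
  swapAdj fzero fzero = fsuc fzero
  swapAdj fzero (fsuc fzero) = fzero
  swapAdj fzero (fsuc (fsuc c)) = fsuc (fsuc c)
  swapAdj (fsuc j) fzero = fzero
  swapAdj (fsuc j) (fsuc c) = fsuc (swapAdj j c)

  det-swap-adjacent : ∀ n (j : Fin n) (M : Fin (suc n) → Fin (suc n) → Carrier) →
    det (suc n) (λ r c → M r (swapAdj j c)) ≈ - det (suc n) M
  det-swap-adjacent (suc n) fzero M = inverseʳ-unique (det (suc (suc n)) M) (det (suc (suc n)) M')
    (trans (+-cong (det-expand2 n M) (det-expand2 n M'))
           (expand2-antisymmetric (λ a b → M a fzero * M b (fsuc fzero)) (λ a b → M a (fsuc fzero) * M b fzero)
                                  (λ x y → *-comm _ _) n (λ σ → det n (λ r c → M (σ r) (fsuc (fsuc c)))) (λ i → i) (minor2-ext n M)))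
    where M' = λ r c → M r (swapAdj fzero c)
  det-swap-adjacent (suc n) (fsuc j) M = begin
      det (suc (suc n)) (λ r c → M r (swapAdj (fsuc j) c))
    ≈⟨ sumFin-cong (suc (suc n)) {cofactorTerm (λ r c → M r (swapAdj (fsuc j) c))} {negated}
         (λ i → *-cong refl (*-cong refl (det-swap-adjacent n j (minor M i)))) ⟩
      sumFin (suc (suc n)) negated
    ≈⟨ sumFin-cong (suc (suc n)) {negated} {λ i → - cofactorTerm M i} (λ i → trans (*-cong refl (sym (-‿distribʳ-* _ _))) (sym (-‿distribʳ-* _ _))) ⟩
      sumFin (suc (suc n)) (λ i → - cofactorTerm M i)
    ≈⟨ sumFin-neg (suc (suc n)) (cofactorTerm M) ⟩
      - det (suc (suc n)) M ∎
    where negated : Fin (suc (suc n)) → Carrier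
          negated i = sgn (toℕ i) * (M i fzero * - det (suc n) (minor M i))

  det-equal-columns : ∀ n (j : Fin n) (M : Fin (suc n) → Fin (suc n) → Carrier) →
    (∀ r → M r fzero ≈ M r (fsuc j)) → det (suc n) M ≈ 0#
  det-equal-columns (suc n) fzero M col0≈col1 = trans (det-expand2 n M)
    (expand2-symmetric _ (λ x y → trans (*-cong (col0≈col1 x) (sym (col0≈col1 y))) (*-comm _ _))
                       n (λ σ → det n (λ r c → M (σ r) (fsuc (fsuc c)))) (λ i → i) (minor2-ext n M))
  det-equal-columns (suc n) (fsuc j) M col0≈col = neg≈0 (trans (sym (det-swap-adjacent (suc n) fzero M))
    (sumFin-zero (suc (suc n)) (cofactorTerm M')
      (λ i → trans (*-cong refl (*-cong refl (det-equal-columns n j (minor M' i) (λ r → col0≈col (punchIn i r)))))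
                   (trans (*-cong refl (zeroʳ _)) (zeroʳ _)))))
    where M' = λ r c → M r (swapAdj fzero c)
          neg≈0 : ∀ {x} → - x ≈ 0# → x ≈ 0#
          neg≈0 {x} -x≈0 = trans (sym (-‿involutive x)) (trans (-‿cong -x≈0) -0#≈0#)

  rotateIndex : ∀ n → Fin (suc n) → ℕ
  rotateIndex n fzero = suc n
  rotateIndex n (fsuc c) = suc (toℕ c)

  det-rotate-columns : ∀ n (f : ℕ → Fin (suc n) → Carrier) →
    det (suc n) (λ r c → f (suc (toℕ c)) r) ≈ sgn n * det (suc n) (λ r c → f (rotateIndex n c) r)
  det-rotate-columns zero f = sym (*-identityˡ _)
  det-rotate-columns (suc n) f = begin
      det (suc (suc n)) (λ r c → f (suc (toℕ c)) r)
    ≈⟨ sumFin-cong (suc (suc n)) {cofactorTerm (λ r c → f (suc (toℕ c)) r)} {λ i → sgn (toℕ i) * (f 1 i * (sgn n * det (suc n) (minor M' i)))}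
         (λ i → *-cong refl (*-cong refl (trans (det-rotate-columns n (λ u r → f (suc u) (punchIn i r)))
           (*-cong refl (det-cong (suc n) {λ r c → f (suc (rotateIndex n c)) (punchIn i r)} {minor M' i}
                                          (λ r → λ { fzero → refl ; (fsuc c) → refl })))))) ⟩
      sumFin (suc (suc n)) (λ i → sgn (toℕ i) * (f 1 i * (sgn n * det (suc n) (minor M' i))))
    ≈⟨ sumFin-cong (suc (suc n)) (λ i → regroup (sgn (toℕ i)) (f 1 i) (sgn n) (det (suc n) (minor M' i))) ⟩
      sumFin (suc (suc n)) (λ i → sgn n * cofactorTerm M' i)
    ≈⟨ sym (sumFin-*ˡ (suc (suc n)) (sgn n) (cofactorTerm M')) ⟩
      sgn n * det (suc (suc n)) M'
    ≈⟨ *-cong refl (det-swap-adjacent (suc n) fzero M) ⟩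
      sgn n * - det (suc (suc n)) M
    ≈⟨ trans (sym (-‿distribʳ-* _ _)) (-‿distribˡ-* _ _) ⟩
      - sgn n * det (suc (suc n)) M ∎
    where M : Fin (suc (suc n)) → Fin (suc (suc n)) → Carrier
          M = λ r c → f (rotateIndex (suc n) c) r
          M' : Fin (suc (suc n)) → Fin (suc (suc n)) → Carrier
          M' = λ r c → M r (swapAdj fzero c)
          regroup : ∀ s u t d → s * (u * (t * d)) ≈ t * (s * (u * d))
          regroup = solve 4 (λ s u t d → s :* (u :* (t :* d)) := t :* (s :* (u :* d))) refl

  replaceCol0 : ∀ {n} → (Fin (suc n) → Carrier) → (Fin (suc n) → Fin (suc n) → Carrier) → Fin (suc n) → Fin (suc n) → Carrier
  replaceCol0 v M r fzero = v r
  replaceCol0 v M r (fsuc c) = M r (fsuc c)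

  det-linear-col0 : ∀ n (M : Fin (suc n) → Fin (suc n) → Carrier) K (coeff : ℕ → Carrier) (V : ℕ → Fin (suc n) → Carrier) →
    (∀ r → M r fzero ≈ Σ< K (λ l → coeff l * V l r)) →
    det (suc n) M ≈ Σ< K (λ l → coeff l * det (suc n) (replaceCol0 (V l) M))
  det-linear-col0 n M K coeff V col0≈ = begin
      det (suc n) M
    ≈⟨ sumFin-cong (suc n) (λ i → trans (*-cong refl (trans (*-cong (col0≈ i) refl) (Σ<-*ʳ K (m i) (λ l → coeff l * V l i))))
          (trans (Σ<-*ˡ K (sgn (toℕ i)) (λ l → (coeff l * V l i) * m i)) (Σ<-cong K (λ l → regroup (sgn (toℕ i)) (coeff l) (V l i) (m i))))) ⟩
      sumFin (suc n) (λ i → Σ< K (λ l → coeff l * (sgn (toℕ i) * (V l i * m i))))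
    ≈⟨ sumFin-Σ< (suc n) K (λ i l → coeff l * (sgn (toℕ i) * (V l i * m i))) ⟩
      Σ< K (λ l → sumFin (suc n) (λ i → coeff l * (sgn (toℕ i) * (V l i * m i))))
    ≈⟨ Σ<-cong K (λ l → sym (sumFin-*ˡ (suc n) (coeff l) (cofactorTerm (replaceCol0 (V l) M)))) ⟩
      Σ< K (λ l → coeff l * det (suc n) (replaceCol0 (V l) M)) ∎
    where m = λ i → det n (minor M i)
          regroup : ∀ s c v d → s * ((c * v) * d) ≈ c * (s * (v * d))
          regroup = solve 4 (λ s c v d → s :* ((c :* v) :* d) := c :* (s :* (v :* d))) refl

  -- A composition placed
  -- after the first p positions gets weight Π z_ℓ · q^{maj}, the descents
  -- being counted at their absolute positions; gen w K n p sums this over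
  -- the compositions of n with parts ≤ K, so F K n z q is gen z K n 0 and
  -- F K n (E m q z) q will turn out to be gen z K n m.
  module Weights (q : Carrier) where

    layerWt : (ℕ → Carrier) → ℕ → ℕ → Carrier
    layerWt w ℓ p = w ℓ * pow q ((ℓ ∸ 1) *ℕ p +ℕ ℓ C 2)

    compWt : (ℕ → Carrier) → ℕ → List ℕ → Carrier
    compWt w p ls = prodL ls w * pow q (majFrom (suc p) (rlpFrom p ls))

    compWt-[] : ∀ w p → compWt w p [] ≈ 1#
    compWt-[] w p = *-identityˡ _

    compWt-∷ : ∀ w p ℓ ls → compWt w p (ℓ ∷ ls) ≈ layerWt w ℓ p * compWt w (p +ℕ ℓ) ls
    compWt-∷ w p ℓ ls = begin
        (w ℓ * prodL ls w) * pow q (majFrom (suc p) (rlpFrom p (ℓ ∷ ls)))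
      ≈⟨ *-cong refl (pow-cong q (majFrom-rlp-∷ ℓ (suc p) p ls)) ⟩
        (w ℓ * prodL ls w) * pow q (descentSum (suc p) ℓ +ℕ rest)
      ≈⟨ *-cong refl (pow-+ q (descentSum (suc p) ℓ) rest) ⟩
        (w ℓ * prodL ls w) * (pow q (descentSum (suc p) ℓ) * pow q rest)
      ≈⟨ interchange _ _ _ _ ⟩
        (w ℓ * pow q (descentSum (suc p) ℓ)) * (prodL ls w * pow q rest)
      ≈⟨ *-cong (*-cong refl (pow-cong q (layerMaj ℓ p))) refl ⟩
        layerWt w ℓ p * compWt w (p +ℕ ℓ) ls ∎
      where
      rest = majFrom (suc (p +ℕ ℓ)) (rlpFrom (p +ℕ ℓ) ls)
      interchange : ∀ a b c d → (a * b) * (c * d) ≈ (a * c) * (b * d)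
      interchange = solve 4 (λ a b c d → (a :* b) :* (c :* d) := (a :* c) :* (b :* d)) refl

    genFuel : (ℕ → Carrier) → ℕ → ℕ → ℕ → ℕ → Carrier
    genFuel w K f n p = Σl (compsFuel K f n) (compWt w p)

    gen : (ℕ → Carrier) → ℕ → ℕ → ℕ → Carrier
    gen w K n p = genFuel w K n n p

    genFuel-unfold : ∀ w K f n p → genFuel w K (suc f) (suc n) p ≈
      Σ< K (λ x → if does (suc x ≤? suc n) then layerWt w (suc x) p * genFuel w K f (n ∸ x) (p +ℕ suc x) else 0#)
    genFuel-unfold w K f n p = begin
        Σl (concatMap tails (filter (_≤? suc n) lengths)) (compWt w p)
      ≈⟨ Σl-concatMap tails (filter (_≤? suc n) lengths) (compWt w p) ⟩
        Σl (filter (_≤? suc n) lengths) (λ ℓ → Σl (tails ℓ) (compWt w p))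
      ≈⟨ Σl-filter (_≤? suc n) lengths (λ ℓ → Σl (tails ℓ) (compWt w p)) ⟩
        Σl lengths (λ ℓ → if does (ℓ ≤? suc n) then Σl (tails ℓ) (compWt w p) else 0#)
      ≡⟨ P.trans (Σl-map suc (upTo K) _) (Σl-applyUpTo (λ i → i) K _) ⟩
        Σ< K (λ x → if does (suc x ≤? suc n) then Σl (tails (suc x)) (compWt w p) else 0#)
      ≈⟨ Σ<-cong K (λ x → if-cong (does (suc x ≤? suc n)) (first-layer (suc x))) ⟩
        Σ< K (λ x → if does (suc x ≤? suc n) then layerWt w (suc x) p * genFuel w K f (n ∸ x) (p +ℕ suc x) else 0#) ∎
      where
      lengths = map suc (upTo K)
      tails : ℕ → List (List ℕ)
      tails ℓ = map (ℓ ∷_) (compsFuel K f (suc n ∸ ℓ))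
      if-cong : ∀ (b : Bool) {u u' v : Carrier} → u ≈ u' → (if b then u else v) ≈ (if b then u' else v)
      if-cong true u≈u' = u≈u'
      if-cong false _ = refl
      first-layer : ∀ ℓ → Σl (tails ℓ) (compWt w p) ≈ layerWt w ℓ p * genFuel w K f (suc n ∸ ℓ) (p +ℕ ℓ)
      first-layer ℓ = begin
          Σl (map (ℓ ∷_) (compsFuel K f (suc n ∸ ℓ))) (compWt w p)
        ≡⟨ Σl-map (ℓ ∷_) (compsFuel K f (suc n ∸ ℓ)) (compWt w p) ⟩
          Σl (compsFuel K f (suc n ∸ ℓ)) (λ ls → compWt w p (ℓ ∷ ls))
        ≈⟨ Σl-cong (compsFuel K f (suc n ∸ ℓ)) (compWt-∷ w p ℓ) ⟩
          Σl (compsFuel K f (suc n ∸ ℓ)) (λ ls → layerWt w ℓ p * compWt w (p +ℕ ℓ) ls)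
        ≈⟨ sym (Σl-*ˡ (compsFuel K f (suc n ∸ ℓ)) (layerWt w ℓ p) (compWt w (p +ℕ ℓ))) ⟩
          layerWt w ℓ p * genFuel w K f (suc n ∸ ℓ) (p +ℕ ℓ) ∎

    genFuel-irrelevant : ∀ w K f f' n p → n ≤ f → n ≤ f' → genFuel w K f n p ≈ genFuel w K f' n p
    genFuel-irrelevant w K zero zero zero p _ _ = refl
    genFuel-irrelevant w K zero (suc f') zero p _ _ = refl
    genFuel-irrelevant w K (suc f) zero zero p _ _ = refl
    genFuel-irrelevant w K (suc f) (suc f') zero p _ _ = refl
    genFuel-irrelevant w K (suc f) (suc f') (suc n) p (s≤s n≤f) (s≤s n≤f') =
      trans (genFuel-unfold w K f n p)
        (trans (Σ<-cong K (λ x → if-cong x))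
               (sym (genFuel-unfold w K f' n p)))
      where
      n-x≤ : ∀ x {g} → n ≤ g → n ∸ x ≤ g
      n-x≤ x = NP.≤-trans (NP.m∸n≤m n x)
      if-cong : ∀ x → (if does (suc x ≤? suc n) then layerWt w (suc x) p * genFuel w K f (n ∸ x) (p +ℕ suc x) else 0#)
                    ≈ (if does (suc x ≤? suc n) then layerWt w (suc x) p * genFuel w K f' (n ∸ x) (p +ℕ suc x) else 0#)
      if-cong x with does (suc x ≤? suc n)
      ... | true = *-cong refl (genFuel-irrelevant w K f f' (n ∸ x) _ (n-x≤ x n≤f) (n-x≤ x n≤f'))
      ... | false = refl

    -- genI w K a b p: compositions of the interval (b, a] (of length a - b),
    -- placed after p positions; 0 when a < b.
    genI : (ℕ → Carrier) → ℕ → ℕ → ℕ → ℕ → Carrier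
    genI w K a zero p = gen w K a p
    genI w K zero (suc b) p = 0#
    genI w K (suc a) (suc b) p = genI w K a b p

    genI-≤ : ∀ w K a b p → b ≤ a → genI w K a b p ≡ gen w K (a ∸ b) p
    genI-≤ w K a zero p _ = P.refl
    genI-≤ w K (suc a) (suc b) p (s≤s b≤a) = genI-≤ w K a b p b≤a

    genI-< : ∀ w K a b p → a < b → genI w K a b p ≡ 0#
    genI-< w K zero (suc b) p _ = P.refl
    genI-< w K (suc a) (suc b) p (s≤s a<b) = genI-< w K a b p a<b

    genI-shift : ∀ w K c a b p → genI w K (c +ℕ a) (c +ℕ b) p ≡ genI w K a b p
    genI-shift w K zero a b p = P.refl
    genI-shift w K (suc c) a b p = genI-shift w K c a b p

    gen-zero : ∀ w K p → gen w K 0 p ≈ 1#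
    gen-zero w K p = trans (+-identityʳ _) (compWt-[] w p)

    genI-empty : ∀ w K a p → genI w K a a p ≈ 1#
    genI-empty w K zero p = gen-zero w K p
    genI-empty w K (suc a) p = genI-empty w K a p

    gen-first-layer : ∀ w K n p → gen w K (suc n) p ≈ Σ< K (λ x → layerWt w (suc x) p * genI w K n x (p +ℕ suc x))
    gen-first-layer w K n p = trans (genFuel-unfold w K n n p) (Σ<-cong K branch)
      where
      branch : ∀ x → (if does (suc x ≤? suc n) then layerWt w (suc x) p * genFuel w K n (n ∸ x) (p +ℕ suc x) else 0#)
                   ≈ layerWt w (suc x) p * genI w K n x (p +ℕ suc x)
      branch x with x ≤? n
      ... | yes x≤n = trans (reflexive (if-true (dec-true (suc x ≤? suc n) (s≤s x≤n))))
          (*-cong refl (trans (genFuel-irrelevant w K n (n ∸ x) (n ∸ x) _ (NP.m∸n≤m n x) NP.≤-refl)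
                              (reflexive (P.sym (genI-≤ w K n x _ x≤n)))))
      ... | no x≰n = trans (reflexive (if-false (dec-false (suc x ≤? suc n) (λ x+1≤n+1 → x≰n (NP.≤-pred x+1≤n+1)))))
          (sym (trans (*-cong refl (reflexive (genI-< w K n x _ (NP.≰⇒> x≰n)))) (zeroʳ _)))

    genI-first-layer : ∀ w K a u p →
      genI w K a u p ≈ δ a u + Σ< K (λ x → layerWt w (suc x) p * genI w K a (u +ℕ suc x) (p +ℕ suc x))
    genI-first-layer w K zero zero p =
      trans (gen-zero w K p) (sym (trans (+-cong refl (Σ<-zero K (λ x _ → zeroʳ _))) (+-identityʳ _)))
    genI-first-layer w K (suc a) zero p = trans (gen-first-layer w K a p) (sym (+-identityˡ _))
    genI-first-layer w K zero (suc u) p = sym (trans (+-cong refl (Σ<-zero K (λ x _ → zeroʳ _))) (+-identityʳ _))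
    genI-first-layer w K (suc a) (suc u) p = genI-first-layer w K a u p

    Σ<-genI-reindex : ∀ w K N x p (φ : ℕ → Carrier) →
      Σ< N (λ j → φ j * genI w K j x p) ≈ Σ< (N ∸ x) (λ j → φ (x +ℕ j) * gen w K j p)
    Σ<-genI-reindex w K N zero p φ = refl
    Σ<-genI-reindex w K zero (suc x) p φ = refl
    Σ<-genI-reindex w K (suc N) (suc x) p φ =
      trans (+-cong (zeroʳ (φ 0)) (Σ<-genI-reindex w K N x p (λ j → φ (suc j)))) (+-identityˡ _)

    layerWt-E : ∀ w m ℓ p → layerWt (E m q w) ℓ p ≈ layerWt w ℓ (p +ℕ m)
    layerWt-E w m ℓ p = trans (*-assoc _ _ _)
      (*-cong refl (trans (sym (pow-+ q ((ℓ ∸ 1) *ℕ m) ((ℓ ∸ 1) *ℕ p +ℕ ℓ C 2)))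
                          (pow-cong q (ExponentArithmetic.shift-exponent (ℓ ∸ 1) m p (ℓ C 2)))))

    compWt-E : ∀ w m p ls → compWt (E m q w) p ls ≈ compWt w (p +ℕ m) ls
    compWt-E w m p [] = trans (compWt-[] (E m q w) p) (sym (compWt-[] w (p +ℕ m)))
    compWt-E w m p (ℓ ∷ ls) = begin
        compWt (E m q w) p (ℓ ∷ ls)
      ≈⟨ compWt-∷ (E m q w) p ℓ ls ⟩
        layerWt (E m q w) ℓ p * compWt (E m q w) (p +ℕ ℓ) ls
      ≈⟨ *-cong (layerWt-E w m ℓ p) (trans (compWt-E w m (p +ℕ ℓ) ls) (reflexive (P.cong (λ u → compWt w u ls) swap))) ⟩
        layerWt w ℓ (p +ℕ m) * compWt w ((p +ℕ m) +ℕ ℓ) ls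
      ≈⟨ sym (compWt-∷ w (p +ℕ m) ℓ ls) ⟩
        compWt w (p +ℕ m) (ℓ ∷ ls) ∎
      where swap : (p +ℕ ℓ) +ℕ m ≡ (p +ℕ m) +ℕ ℓ
            swap = P.trans (NP.+-assoc p ℓ m) (P.trans (P.cong (p +ℕ_) (NP.+-comm ℓ m)) (P.sym (NP.+-assoc p m ℓ)))

    gen-E : ∀ w K n m p → gen (E m q w) K n p ≈ gen w K n (p +ℕ m)
    gen-E w K n m p = Σl-cong (compsFuel K n n) (compWt-E w m p)

    genI-E : ∀ w K a b m p → genI (E m q w) K a b p ≈ genI w K a b (p +ℕ m)
    genI-E w K a zero m p = gen-E w K a m p
    genI-E w K zero (suc b) m p = refl
    genI-E w K (suc a) (suc b) m p = genI-E w K a b m p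

    module Segments (w : ℕ → Carrier) (K' : ℕ) where
      K : ℕ
      K = suc K'

      g : ℕ → ℕ → ℕ → Carrier
      g = genI w K

      a : ℕ → ℕ → Carrier
      a = layerWt w

      -- seg e s: compositions covering the positions s+1, …, e in place.
      seg : ℕ → ℕ → Carrier
      seg e s = g e s s

      -- A layer of length y+2 occupying positions c-j, …, c-j+y+1 (so that it
      -- straddles the cut after position c, 1 ≤ j ≤ y+1), with arbitrary
      -- compositions of (s, c-j] on its left and of (c-j+y+2, e] on its right.
      straddleTerm : ℕ → ℕ → ℕ → ℕ → ℕ → Carrier
      straddleTerm s c e y j = a (suc (suc y)) (c ∸ suc j)
        * (g c (suc j +ℕ s) s * g (e +ℕ suc j) (c +ℕ suc (suc y)) ((c +ℕ suc (suc y)) ∸ suc j))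

      straddle : ℕ → ℕ → ℕ → Carrier
      straddle s c e = Σ< K' (λ y → Σ< (suc y) (λ j → straddleTerm s c e y j))

      straddle-empty : ∀ s c e → c ≤ s → straddle s c e ≈ 0#
      straddle-empty s c e c≤s = Σ<-zero K' (λ y _ → Σ<-zero (suc y) {λ j → straddleTerm s c e y j} (λ j _ →
        trans (*-cong refl (trans (*-cong (reflexive (genI-< w K c (suc j +ℕ s) s left-empty)) refl) (zeroˡ _))) (zeroʳ _)))
        where left-empty : ∀ {j} → c < suc j +ℕ s
              left-empty {j} = s≤s (NP.≤-trans c≤s (NP.m≤n+m s j))

      seg-step : ∀ e s → s < e → seg e s ≈ Σ< K (λ x → a (suc x) s * seg e (s +ℕ suc x))
      seg-step e s s<e = trans (genI-first-layer w K e s s) (trans (+-cong (δ-≢ e s (NP.>⇒≢ s<e)) refl) (+-identityˡ _))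

      -- The part of a straddle term in which the left composition is empty.
      cornerTerm : ℕ → ℕ → ℕ → ℕ → ℕ → Carrier
      cornerTerm s c e y j = a (suc (suc y)) (c ∸ suc j)
        * (δ c (suc j +ℕ s) * g (e +ℕ suc j) (c +ℕ suc (suc y)) ((c +ℕ suc (suc y)) ∸ suc j))

      straddleTerm-step : ∀ s c e y j →
        straddleTerm s c e y j ≈ cornerTerm s c e y j + Σ< K (λ x → a (suc x) s * straddleTerm (s +ℕ suc x) c e y j)
      straddleTerm-step s c e y j = begin
          A * (g c (suc j +ℕ s) s * B)
        ≈⟨ *-cong refl (*-cong (genI-first-layer w K c (suc j +ℕ s) s) refl) ⟩
          A * ((δ c (suc j +ℕ s) + Σ< K f) * B)
        ≈⟨ distrib-split A (δ c (suc j +ℕ s)) (Σ< K f) B ⟩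
          A * (δ c (suc j +ℕ s) * B) + A * (Σ< K f * B)
        ≈⟨ +-cong refl (trans (*-cong refl (Σ<-*ʳ K B f)) (Σ<-*ˡ K A (λ x → f x * B))) ⟩
          A * (δ c (suc j +ℕ s) * B) + Σ< K (λ x → A * (f x * B))
        ≈⟨ +-cong refl (Σ<-cong K (λ x → trans (regroup A (a (suc x) s) (g c ((suc j +ℕ s) +ℕ suc x) (s +ℕ suc x)) B)
               (*-cong refl (*-cong refl (*-cong (reflexive (P.cong (λ t → g c t (s +ℕ suc x)) (NP.+-assoc (suc j) s (suc x)))) refl))))) ⟩
          A * (δ c (suc j +ℕ s) * B) + Σ< K (λ x → a (suc x) s * straddleTerm (s +ℕ suc x) c e y j) ∎
        where
        A = a (suc (suc y)) (c ∸ suc j)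
        B = g (e +ℕ suc j) (c +ℕ suc (suc y)) ((c +ℕ suc (suc y)) ∸ suc j)
        f = λ x → a (suc x) s * g c ((suc j +ℕ s) +ℕ suc x) (s +ℕ suc x)
        distrib-split : ∀ A d S B → A * ((d + S) * B) ≈ A * (d * B) + A * (S * B)
        distrib-split = solve 4 (λ A d S B → A :* ((d :+ S) :* B) := A :* (d :* B) :+ A :* (S :* B)) refl
        regroup : ∀ A u v B → A * ((u * v) * B) ≈ u * (A * (v * B))
        regroup = solve 4 (λ A u v B → A :* ((u :* v) :* B) := u :* (A :* (v :* B))) refl

      corners : ℕ → ℕ → ℕ → ℕ → Carrier
      corners s c e y = Σ< (suc y) (λ j → cornerTerm s c e y j)

      straddle-step : ∀ s c e → straddle s c e ≈ Σ< K' (corners s c e) + Σ< K (λ x → a (suc x) s * straddle (s +ℕ suc x) c e)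
      straddle-step s c e = begin
          Σ< K' (λ y → Σ< (suc y) (λ j → straddleTerm s c e y j))
        ≈⟨ Σ<-cong K' (λ y → Σ<-cong (suc y) (λ j → straddleTerm-step s c e y j)) ⟩
          Σ< K' (λ y → Σ< (suc y) (λ j → cornerTerm s c e y j + Q y j))
        ≈⟨ Σ<-cong K' (λ y → Σ<-+ (suc y) (cornerTerm s c e y) (Q y)) ⟩
          Σ< K' (λ y → corners s c e y + Σ< (suc y) (Q y))
        ≈⟨ Σ<-+ K' (corners s c e) (λ y → Σ< (suc y) (Q y)) ⟩
          Σ< K' (corners s c e) + Σ< K' (λ y → Σ< (suc y) (Q y))
        ≈⟨ +-cong refl (Σ<-cong K' (λ y → Σ<-swap (suc y) K (λ j x → a (suc x) s * straddleTerm (s +ℕ suc x) c e y j))) ⟩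
          Σ< K' (corners s c e) + Σ< K' (λ y → Σ< K (λ x → Σ< (suc y) (λ j → a (suc x) s * straddleTerm (s +ℕ suc x) c e y j)))
        ≈⟨ +-cong refl (Σ<-swap K' K (λ y x → Σ< (suc y) (λ j → a (suc x) s * straddleTerm (s +ℕ suc x) c e y j))) ⟩
          Σ< K' (corners s c e) + Σ< K (λ x → Σ< K' (λ y → Σ< (suc y) (λ j → a (suc x) s * straddleTerm (s +ℕ suc x) c e y j)))
        ≈⟨ +-cong refl (Σ<-cong K (λ x → sym (trans (Σ<-*ˡ K' (a (suc x) s) (λ y → Σ< (suc y) (λ j → straddleTerm (s +ℕ suc x) c e y j)))
              (Σ<-cong K' (λ y → Σ<-*ˡ (suc y) (a (suc x) s) (λ j → straddleTerm (s +ℕ suc x) c e y j)))))) ⟩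
          Σ< K' (corners s c e) + Σ< K (λ x → a (suc x) s * straddle (s +ℕ suc x) c e) ∎
        where
        Q : ℕ → ℕ → Carrier
        Q y j = Σ< K (λ x → a (suc x) s * straddleTerm (s +ℕ suc x) c e y j)

      cornerFactor : ℕ → ℕ → ℕ → ℕ → ℕ → Carrier
      cornerFactor s c e y j = a (suc (suc y)) (c ∸ suc j) * g (e +ℕ suc j) (c +ℕ suc (suc y)) ((c +ℕ suc (suc y)) ∸ suc j)

      corners-δ : ∀ s d' e y → corners s (s +ℕ suc d') e y ≈ Σ< (suc y) (λ j → δ d' j * cornerFactor s (s +ℕ suc d') e y j)
      corners-δ s d' e y = Σ<-cong (suc y) (λ j →
        trans (swap-middle (a (suc (suc y)) (c ∸ suc j)) (δ c (suc j +ℕ s)) (g (e +ℕ suc j) (c +ℕ suc (suc y)) ((c +ℕ suc (suc y)) ∸ suc j)))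
              (*-cong (reflexive (δ-shift s (suc d') (suc j))) refl))
        where c = s +ℕ suc d'
              swap-middle : ∀ A d B → A * (d * B) ≈ d * (A * B)
              swap-middle = solve 3 (λ A d B → A :* (d :* B) := d :* (A :* B)) refl

      -- The straddling layer starts at s+1: what remains is the segment after it.
      corner-hit : ∀ s d' e y → d' < suc y → corners s (s +ℕ suc d') e y ≈ a (suc (suc y)) s * seg e (s +ℕ suc (suc y))
      corner-hit s d' e y d'≤y = trans (corners-δ s d' e y) (trans (Σ<-δ (suc y) d' (cornerFactor s c e y) d'≤y)
        (*-cong (reflexive (P.cong (a (suc (suc y))) (NP.m+n∸n≡m s (suc d')))) (reflexive right-segment)))
        where
        c = s +ℕ suc d'
        c+i≡ : c +ℕ suc (suc y) ≡ suc d' +ℕ (s +ℕ suc (suc y))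
        c+i≡ = P.trans (NP.+-assoc s (suc d') (suc (suc y))) (P.trans (P.cong (s +ℕ_) (NP.+-comm (suc d') (suc (suc y))))
               (P.trans (P.sym (NP.+-assoc s (suc (suc y)) (suc d'))) (NP.+-comm (s +ℕ suc (suc y)) (suc d'))))
        right-segment : g (e +ℕ suc d') (c +ℕ suc (suc y)) ((c +ℕ suc (suc y)) ∸ suc d') ≡ seg e (s +ℕ suc (suc y))
        right-segment = P.trans (P.cong₂ (λ u v → g u v ((c +ℕ suc (suc y)) ∸ suc d')) (NP.+-comm e (suc d')) c+i≡)
          (P.trans (genI-shift w K (suc d') e (s +ℕ suc (suc y)) _)
                   (P.cong (g e (s +ℕ suc (suc y))) (P.trans (P.cong (_∸ suc d') c+i≡) (NP.m+n∸m≡n (suc d') _))))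

      corner-miss : ∀ s d' e y → suc y ≤ d' → corners s (s +ℕ suc d') e y ≈ 0#
      corner-miss s d' e y y<d' = trans (corners-δ s d' e y) (Σ<-δ-outside (suc y) d' (cornerFactor s (s +ℕ suc d') e y) y<d')

      -- The cut identity: for s ≤ c ≤ e, a composition of (s, e] either has a
      -- layer boundary at c, splitting it into compositions of (s, c] and
      -- (c, e], or has a layer straddling c.  Proved by strong induction on
      -- d = c - s (bounded by D), peeling the first layer after s.
      cut : ∀ D d s c e → d ≤ D → c ≡ s +ℕ d → c ≤ e → seg e s ≈ seg c s * seg e c + straddle s c e
      cut D zero s c e _ c≡s+0 c≤e with P.trans c≡s+0 (NP.+-identityʳ s)
      ... | P.refl = sym (trans (+-cong (*-cong (genI-empty w K s s) refl) (straddle-empty s s e NP.≤-refl))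
                                (trans (+-identityʳ _) (*-identityˡ _)))
      cut (suc D) (suc d') s .(s +ℕ suc d') e (s≤s d'≤D) P.refl c≤e = begin
          seg e s
        ≈⟨ seg-step e s s<e ⟩
          Σ< K (λ x → ax x * seg e (S x))
        ≈⟨ +-cong (*-cong refl (IH 0 z≤n)) (Σ<-cong K' later-layers) ⟩
          ax 0 * Br 0 + Σ< K' (λ y → ax (suc y) * Br (suc y) + corners s c e y)
        ≈⟨ +-cong refl (Σ<-+ K' (λ y → ax (suc y) * Br (suc y)) (corners s c e)) ⟩
          ax 0 * Br 0 + (Σ< K' (λ y → ax (suc y) * Br (suc y)) + Σ< K' (corners s c e))
        ≈⟨ sym (+-assoc _ _ _) ⟩
          Σ< K (λ x → ax x * Br x) + Σ< K' (corners s c e)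
        ≈⟨ +-cong (Σ<-cong K (λ x → distribˡ (ax x) (seg c (S x) * seg e c) (straddle (S x) c e))) refl ⟩
          Σ< K (λ x → ax x * (seg c (S x) * seg e c) + ax x * straddle (S x) c e) + Σ< K' (corners s c e)
        ≈⟨ +-cong (Σ<-+ K (λ x → ax x * (seg c (S x) * seg e c)) (λ x → ax x * straddle (S x) c e)) refl ⟩
          (Σ< K (λ x → ax x * (seg c (S x) * seg e c)) + Σ< K (λ x → ax x * straddle (S x) c e)) + Σ< K' (corners s c e)
        ≈⟨ regroup _ _ _ ⟩
          Σ< K (λ x → ax x * (seg c (S x) * seg e c)) + (Σ< K' (corners s c e) + Σ< K (λ x → ax x * straddle (S x) c e))
        ≈⟨ +-cong boundary (sym (straddle-step s c e)) ⟩
          seg c s * seg e c + straddle s c e ∎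
        where
        c = s +ℕ suc d'
        s<c : s < c
        s<c = NP.m<m+n s (s≤s z≤n)
        s<e : s < e
        s<e = NP.<-≤-trans s<c c≤e
        ax : ℕ → Carrier
        ax x = a (suc x) s
        S : ℕ → ℕ
        S x = s +ℕ suc x
        Br : ℕ → Carrier
        Br x = seg c (S x) * seg e c + straddle (S x) c e
        IH : ∀ x → x ≤ d' → seg e (S x) ≈ Br x
        IH x x≤d' = cut D (d' ∸ x) (S x) c e (NP.≤-trans (NP.m∸n≤m d' x) d'≤D) c≡ c≤e
          where c≡ : c ≡ S x +ℕ (d' ∸ x)
                c≡ = P.sym (P.trans (NP.+-assoc s (suc x) (d' ∸ x)) (P.cong (λ t → s +ℕ suc t) (NP.m+[n∸m]≡n x≤d')))
        -- a first layer reaching beyond c straddles the cut itself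
        Br-beyond : ∀ x → d' < x → Br x ≈ 0#
        Br-beyond x d'<x = trans (+-cong (trans (*-cong (reflexive (genI-< w K c (S x) (S x) c<S)) refl) (zeroˡ _))
                                         (straddle-empty (S x) c e (NP.<⇒≤ c<S))) (+-identityʳ _)
          where c<S : c < S x
                c<S = NP.+-monoʳ-< s (s≤s d'<x)
        later-layers : ∀ y → ax (suc y) * seg e (S (suc y)) ≈ ax (suc y) * Br (suc y) + corners s c e y
        later-layers y with suc y NP.≤? d'
        ... | yes y<d' = sym (trans (+-cong (*-cong refl (sym (IH (suc y) y<d'))) (corner-miss s d' e y y<d')) (+-identityʳ _))
        ... | no y≮d' = sym (trans (+-cong (trans (*-cong refl (Br-beyond (suc y) (NP.≰⇒> y≮d'))) (zeroʳ _))
                                           (corner-hit s d' e y (NP.≰⇒> y≮d'))) (+-identityˡ _))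
        boundary : Σ< K (λ x → ax x * (seg c (S x) * seg e c)) ≈ seg c s * seg e c
        boundary = trans (Σ<-cong K (λ x → sym (*-assoc (ax x) (seg c (S x)) (seg e c))))
                         (sym (trans (*-cong (seg-step c s s<c) refl) (Σ<-*ʳ K (seg e c) (λ x → ax x * seg c (S x)))))
        regroup : ∀ u v t → (u + v) + t ≈ u + (t + v)
        regroup = solve 3 (λ u v t → (u :+ v) :+ t := u :+ (t :+ v)) refl

      seg-single : ∀ c → seg (suc c) c ≈ a 1 c
      seg-single c = begin
          g (suc c) c c
        ≡⟨ P.cong₂ (λ u v → g u v c) (NP.+-comm 1 c) (P.sym (NP.+-identityʳ c)) ⟩
          g (c +ℕ 1) (c +ℕ 0) c
        ≡⟨ genI-shift w K c 1 0 c ⟩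
          gen w K 1 c
        ≈⟨ gen-first-layer w K 0 c ⟩
          a 1 c * gen w K 0 (c +ℕ 1) + Σ< K' (λ x → a (suc (suc x)) c * 0#)
        ≈⟨ +-cong (trans (*-cong refl (gen-zero w K (c +ℕ 1))) (*-identityʳ _)) (Σ<-zero K' (λ x _ → zeroʳ (a (suc (suc x)) c))) ⟩
          a 1 c + 0#
        ≈⟨ +-identityʳ _ ⟩
          a 1 c ∎

      -- Last-layer recursion: the cut identity at c = e - 1.
      seg-last-layer : ∀ c s → s ≤ c → seg (suc c) s ≈ Σ< K (λ x → a (suc x) (c ∸ x) * g c (x +ℕ s) s)
      seg-last-layer c s s≤c = begin
          seg (suc c) s
        ≈⟨ cut (c ∸ s) (c ∸ s) s c (suc c) NP.≤-refl (P.sym (NP.m+[n∸m]≡n s≤c)) (NP.n≤1+n c) ⟩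
          seg c s * seg (suc c) c + straddle s c (suc c)
        ≈⟨ +-cong (trans (*-cong refl (seg-single c)) (*-comm _ _)) (Σ<-cong K' ending-at-c+1) ⟩
          a 1 c * seg c s + Σ< K' (λ y → a (suc (suc y)) (c ∸ suc y) * g c (suc y +ℕ s) s) ∎
        where
        right-empty : ∀ y j → g (suc c +ℕ suc j) (c +ℕ suc (suc y)) ((c +ℕ suc (suc y)) ∸ suc j) ≡ g j y ((c +ℕ suc (suc y)) ∸ suc j)
        right-empty y j = P.trans (P.cong (λ u → g u (c +ℕ suc (suc y)) ((c +ℕ suc (suc y)) ∸ suc j)) (P.sym (NP.+-suc c (suc j))))
                                  (genI-shift w K c (suc (suc j)) (suc (suc y)) _)
        -- a layer straddling the last position must end there: j = y+1
        ending-at-c+1 : ∀ y → Σ< (suc y) (λ j → straddleTerm s c (suc c) y j) ≈ a (suc (suc y)) (c ∸ suc y) * g c (suc y +ℕ s) s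
        ending-at-c+1 y = begin
            Σ< (suc y) (λ j → straddleTerm s c (suc c) y j)
          ≈⟨ Σ<-last y (λ j → straddleTerm s c (suc c) y j) ⟩
            Σ< y (λ j → straddleTerm s c (suc c) y j) + straddleTerm s c (suc c) y y
          ≈⟨ +-cong (Σ<-zero y (λ j j<y → trans (*-cong refl (trans (*-cong refl (reflexive (P.trans (right-empty y j) (genI-< w K j y _ j<y)))) (zeroʳ _))) (zeroʳ _)))
                    (*-cong refl (trans (*-cong refl (trans (reflexive (right-empty y y)) (genI-empty w K y _))) (*-identityʳ _))) ⟩
            0# + a (suc (suc y)) (c ∸ suc y) * g c (suc y +ℕ s) s
          ≈⟨ +-identityˡ _ ⟩
            a (suc (suc y)) (c ∸ suc y) * g c (suc y +ℕ s) s ∎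

    -- Decomposition by the first layer of maximal length K = K'+1: a
    -- composition with parts ≤ K either has all parts ≤ K', or consists of a
    -- composition with parts ≤ K' of some j, a layer of length K, and an
    -- arbitrary composition of the rest.
    module FirstMaximalLayer (w : ℕ → Carrier) (K' : ℕ) where
      open Segments w K' using (K; seg; seg-step; a)

      g' : ℕ → ℕ → ℕ → Carrier
      g' = genI w K'

      gen' : ℕ → ℕ → Carrier
      gen' = gen w K'

      afterMax : ℕ → ℕ → ℕ → Carrier
      afterMax e s j = seg e (s +ℕ (K +ℕ j))

      -- Terms in which the first maximal layer starts after position s+j+1.
      maxTerms : ℕ → ℕ → ℕ → ℕ → Carrier
      maxTerms e s d' x = Σ< (suc d') (λ j → a K (s +ℕ suc j) * (g' j x (s +ℕ suc x) * afterMax e s (suc j)))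

      short-first-layers : ∀ s d' e → Σ< K' (λ x → a (suc x) s * maxTerms e s d' x)
        ≈ Σ< (suc d') (λ j → a K (s +ℕ suc j) * (gen' (suc j) s * afterMax e s (suc j)))
      short-first-layers s d' e = begin
          Σ< K' (λ x → a (suc x) s * maxTerms e s d' x)
        ≈⟨ Σ<-cong K' (λ x → Σ<-*ˡ (suc d') (a (suc x) s) (λ j → a K (s +ℕ suc j) * (g' j x (S x) * Y j))) ⟩
          Σ< K' (λ x → Σ< (suc d') (λ j → a (suc x) s * (a K (s +ℕ suc j) * (g' j x (S x) * Y j))))
        ≈⟨ Σ<-swap K' (suc d') (λ x j → a (suc x) s * (a K (s +ℕ suc j) * (g' j x (S x) * Y j))) ⟩
          Σ< (suc d') (λ j → Σ< K' (λ x → a (suc x) s * (a K (s +ℕ suc j) * (g' j x (S x) * Y j))))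
        ≈⟨ Σ<-cong (suc d') collect ⟩
          Σ< (suc d') (λ j → a K (s +ℕ suc j) * (gen' (suc j) s * Y j)) ∎
        where
        S : ℕ → ℕ
        S x = s +ℕ suc x
        Y : ℕ → Carrier
        Y j = afterMax e s (suc j)
        regroup : ∀ u v x y → u * (v * (x * y)) ≈ v * ((u * x) * y)
        regroup = solve 4 (λ u v x y → u :* (v :* (x :* y)) := v :* ((u :* x) :* y)) refl
        collect : ∀ j → Σ< K' (λ x → a (suc x) s * (a K (s +ℕ suc j) * (g' j x (S x) * Y j))) ≈ a K (s +ℕ suc j) * (gen' (suc j) s * Y j)
        collect j = trans (Σ<-cong K' (λ x → regroup (a (suc x) s) (a K (s +ℕ suc j)) (g' j x (S x)) (Y j)))
          (trans (sym (Σ<-*ˡ K' (a K (s +ℕ suc j)) (λ x → (a (suc x) s * g' j x (S x)) * Y j)))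
                 (*-cong refl (trans (sym (Σ<-*ʳ K' (Y j) (λ x → a (suc x) s * g' j x (S x))))
                                     (*-cong (sym (gen-first-layer w K' j s)) refl))))

      maxTerms-reindex : ∀ s d' e x → x ≤ d' →
        maxTerms e s d' x ≈ Σ< (suc (d' ∸ x)) (λ j → a K (s +ℕ suc x +ℕ j) * (gen' j (s +ℕ suc x) * afterMax e (s +ℕ suc x) j))
      maxTerms-reindex s d' e x x≤d' = begin
          maxTerms e s d' x
        ≈⟨ Σ<-cong (suc d') (λ j → move-last (a K (s +ℕ suc j)) (g' j x S) (Y j)) ⟩
          Σ< (suc d') (λ j → (a K (s +ℕ suc j) * Y j) * g' j x S)
        ≈⟨ Σ<-genI-reindex w K' (suc d') x S (λ j → a K (s +ℕ suc j) * Y j) ⟩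
          Σ< (suc d' ∸ x) (λ j → (a K (s +ℕ suc (x +ℕ j)) * Y (x +ℕ j)) * gen' j S)
        ≡⟨ P.cong (λ t → Σ< t (λ j → (a K (s +ℕ suc (x +ℕ j)) * Y (x +ℕ j)) * gen' j S)) (NP.+-∸-assoc 1 x≤d') ⟩
          Σ< (suc (d' ∸ x)) (λ j → (a K (s +ℕ suc (x +ℕ j)) * Y (x +ℕ j)) * gen' j S)
        ≈⟨ Σ<-cong (suc (d' ∸ x)) (λ j → trans (move-back (a K (s +ℕ suc (x +ℕ j))) (Y (x +ℕ j)) (gen' j S))
              (*-cong (reflexive (P.cong (a K) (start≡ j))) (*-cong refl (reflexive (P.cong (seg e) (end≡ j)))))) ⟩
          Σ< (suc (d' ∸ x)) (λ j → a K (S +ℕ j) * (gen' j S * afterMax e S j)) ∎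
        where
        S = s +ℕ suc x
        Y : ℕ → Carrier
        Y j = afterMax e s (suc j)
        move-last : ∀ u v t → u * (v * t) ≈ (u * t) * v
        move-last = solve 3 (λ u v t → u :* (v :* t) := (u :* t) :* v) refl
        move-back : ∀ u t v → (u * t) * v ≈ u * (v * t)
        move-back = solve 3 (λ u t v → (u :* t) :* v := u :* (v :* t)) refl
        start≡ : ∀ j → s +ℕ suc (x +ℕ j) ≡ S +ℕ j
        start≡ j = P.sym (NP.+-assoc s (suc x) j)
        end≡ : ∀ j → s +ℕ (K +ℕ suc (x +ℕ j)) ≡ S +ℕ (K +ℕ j)
        end≡ j = P.trans (P.cong (s +ℕ_) (P.trans (NP.+-suc K (x +ℕ j)) (P.cong suc
                   (P.trans (P.sym (NP.+-assoc K x j)) (P.trans (P.cong (_+ℕ j) (NP.+-comm K x)) (NP.+-assoc x K j))))))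
                 (P.sym (NP.+-assoc s (suc x) (K +ℕ j)))

      first-max-layer : ∀ D d s e → d ≤ D → e ≡ s +ℕ d →
        seg e s ≈ g' e s s + Σ< (suc d) (λ j → a K (s +ℕ j) * (gen' j s * afterMax e s j))
      first-max-layer D zero s e _ e≡s+0 with P.trans e≡s+0 (NP.+-identityʳ s)
      ... | P.refl = sym (begin
          g' s s s + (a K (s +ℕ 0) * (gen' 0 s * afterMax s s 0) + 0#)
        ≈⟨ +-cong (genI-empty w K' s s) (trans (+-identityʳ _) (trans (*-cong refl (trans (*-cong refl (reflexive (genI-< w K s _ _ s<))) (zeroʳ _))) (zeroʳ _))) ⟩
          1# + 0#
        ≈⟨ +-identityʳ _ ⟩
          1#
        ≈⟨ sym (genI-empty w K s s) ⟩
          seg s s ∎)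
        where s< : s < s +ℕ (K +ℕ 0)
              s< = NP.m<m+n s (s≤s z≤n)
      first-max-layer (suc D) (suc d') s .(s +ℕ suc d') (s≤s d'≤D) P.refl = begin
          seg e s
        ≈⟨ seg-step e s s<e ⟩
          Σ< K (λ x → a (suc x) s * seg e (S x))
        ≈⟨ Σ<-last K' (λ x → a (suc x) s * seg e (S x)) ⟩
          Σ< K' (λ x → a (suc x) s * seg e (S x)) + a K s * seg e (S K')
        ≈⟨ +-cong (Σ<-cong K' short) refl ⟩
          Σ< K' (λ x → a (suc x) s * (g' e (S x) (S x) + maxTerms e s d' x)) + a K s * seg e (S K')
        ≈⟨ +-cong (trans (Σ<-cong K' (λ x → distribˡ (a (suc x) s) (g' e (S x) (S x)) (maxTerms e s d' x)))
                         (Σ<-+ K' (λ x → a (suc x) s * g' e (S x) (S x)) (λ x → a (suc x) s * maxTerms e s d' x))) refl ⟩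
          (Σ< K' (λ x → a (suc x) s * g' e (S x) (S x)) + Σ< K' (λ x → a (suc x) s * maxTerms e s d' x)) + a K s * seg e (S K')
        ≈⟨ regroup _ _ _ ⟩
          Σ< K' (λ x → a (suc x) s * g' e (S x) (S x)) + (a K s * seg e (S K') + Σ< K' (λ x → a (suc x) s * maxTerms e s d' x))
        ≈⟨ +-cong all-short (+-cong max-first (short-first-layers s d' e)) ⟩
          g' e s s + (a K (s +ℕ 0) * (gen' 0 s * afterMax e s 0) + Σ< (suc d') (λ j → a K (s +ℕ suc j) * (gen' (suc j) s * afterMax e s (suc j)))) ∎
        where
        e = s +ℕ suc d'
        s<e : s < e
        s<e = NP.m<m+n s (s≤s z≤n)
        S : ℕ → ℕ
        S x = s +ℕ suc x
        regroup : ∀ u v t → (u + v) + t ≈ u + (t + v)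
        regroup = solve 3 (λ u v t → (u :+ v) :+ t := u :+ (t :+ v)) refl
        all-short : Σ< K' (λ x → a (suc x) s * g' e (S x) (S x)) ≈ g' e s s
        all-short = sym (trans (genI-first-layer w K' e s s) (trans (+-cong (δ-≢ e s (NP.>⇒≢ s<e)) refl) (+-identityˡ _)))
        max-first : a K s * seg e (S K') ≈ a K (s +ℕ 0) * (gen' 0 s * afterMax e s 0)
        max-first = *-cong (reflexive (P.cong (a K) (P.sym (NP.+-identityʳ s))))
          (sym (trans (*-cong (gen-zero w K' s) refl) (trans (*-identityˡ _) (reflexive (P.cong (λ t → seg e (s +ℕ t)) (NP.+-identityʳ K))))))
        short : ∀ x → a (suc x) s * seg e (S x) ≈ a (suc x) s * (g' e (S x) (S x) + maxTerms e s d' x)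
        short x with x NP.≤? d'
        ... | yes x≤d' = *-cong refl (trans (first-max-layer D (d' ∸ x) (S x) e (NP.≤-trans (NP.m∸n≤m d' x) d'≤D) e≡)
                                            (+-cong refl (sym (maxTerms-reindex s d' e x x≤d'))))
          where e≡ : e ≡ S x +ℕ (d' ∸ x)
                e≡ = P.sym (P.trans (NP.+-assoc s (suc x) (d' ∸ x)) (P.cong (λ t → s +ℕ suc t) (NP.m+[n∸m]≡n x≤d')))
        ... | no x≰d' = trans (*-cong refl (reflexive (genI-< w K e (S x) (S x) e<S)))
                 (sym (*-cong refl (trans (+-cong (reflexive (genI-< w K' e (S x) (S x) e<S)) (Σ<-zero (suc d') {λ j → a K (s +ℕ suc j) * (g' j x (S x) * afterMax e s (suc j))}
                   (λ j j<d'+1 → trans (*-cong refl (trans (*-cong (reflexive (genI-< w K' j x (S x) (NP.≤-<-trans (NP.≤-pred j<d'+1) (NP.≰⇒> x≰d')))) refl) (zeroˡ _))) (zeroʳ _))))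
                   (+-identityʳ _))))
          where e<S : e < S x
                e<S = NP.+-monoʳ-< s (s≤s (NP.≰⇒> x≰d'))

    module SegmentDeterminant (w : ℕ → Carrier) (K' : ℕ) where
      open Segments w K'

      det-unitriangular : ∀ n p → det n (λ s t → seg (p +ℕ toℕ t) (p +ℕ toℕ s)) ≈ 1#
      det-unitriangular zero p = refl
      det-unitriangular (suc n) p = begin
          cofactorTerm M fzero + sumFin n (λ i → cofactorTerm M (fsuc i))
        ≈⟨ +-cong (trans (*-identityˡ _) (*-cong (genI-empty w K (p +ℕ 0) (p +ℕ 0)) (trans (det-cong n shifted) (det-unitriangular n (suc p)))))
                  (sumFin-zero n (λ i → cofactorTerm M (fsuc i)) below-diagonal) ⟩
          1# * 1# + 0#
        ≈⟨ trans (+-identityʳ _) (*-identityˡ _) ⟩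
          1# ∎
        where
        M : Fin (suc n) → Fin (suc n) → Carrier
        M s t = seg (p +ℕ toℕ t) (p +ℕ toℕ s)
        shifted : ∀ r c → minor M fzero r c ≈ seg (suc p +ℕ toℕ c) (suc p +ℕ toℕ r)
        shifted r c = reflexive (P.cong₂ seg (NP.+-suc p (toℕ c)) (NP.+-suc p (toℕ r)))
        below-diagonal : ∀ i → cofactorTerm M (fsuc i) ≈ 0#
        below-diagonal i = trans (*-cong refl (trans (*-cong (reflexive (genI-< w K (p +ℕ 0) (p +ℕ suc (toℕ i)) _ (NP.+-monoʳ-< p (s≤s z≤n)))) refl)
                                                      (zeroˡ _)))
                                 (zeroʳ _)

      segDet : ℕ → Carrier
      segDet N = det K (λ s t → seg (N +ℕ toℕ t) (toℕ s))

      -- The matrix of segDet (N+1) with its last column moved to the front.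
      rotated : ℕ → Fin K → Fin K → Carrier
      rotated N r c = seg (N +ℕ rotateIndex K' c) (toℕ r)

      -- The part of that first column whose last layer has length x+1.
      lastLayerColumn : ℕ → ℕ → Fin K → Carrier
      lastLayerColumn N x r = g (N +ℕ K') (x +ℕ toℕ r) (toℕ r)

      rotated-first-column : ∀ N r → rotated N r fzero ≈ Σ< K (λ x → a (suc x) ((N +ℕ K') ∸ x) * lastLayerColumn N x r)
      rotated-first-column N r = trans (reflexive (P.cong (λ u → seg u (toℕ r)) (NP.+-suc N K')))
        (seg-last-layer (N +ℕ K') (toℕ r) (NP.≤-trans (NP.≤-pred (toℕ<n r)) (NP.m≤n+m K' N)))

      -- A last layer of length x+1 < k reproduces column K'-x-1 of the matrix.
      repeated-column : ∀ N x → x < K' → det K (replaceCol0 (lastLayerColumn N x) (rotated N)) ≈ 0#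
      repeated-column N x x<K' = det-equal-columns K' (fromℕ< j<K') (replaceCol0 (lastLayerColumn N x) (rotated N))
        (λ r → reflexive (P.trans (P.cong (λ u → g u (x +ℕ toℕ r) (toℕ r)) N+K'≡)
                         (P.trans (genI-shift w K x (N +ℕ suc (K' ∸ suc x)) (toℕ r) (toℕ r))
                                  (P.cong (λ u → seg (N +ℕ suc u) (toℕ r)) (P.sym (toℕ-fromℕ< j<K'))))))
        where
        j<K' : K' ∸ suc x < K'
        j<K' = NP.∸-monoʳ-< {K'} {suc x} {0} (s≤s z≤n) x<K'
        N+K'≡ : N +ℕ K' ≡ x +ℕ (N +ℕ suc (K' ∸ suc x))
        N+K'≡ = P.trans (P.cong (N +ℕ_) (P.sym (NP.m+[n∸m]≡n {x} {K'} (NP.<⇒≤ x<K'))))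
                  (P.trans (P.cong (λ u → N +ℕ (x +ℕ u)) (NP.+-∸-assoc 1 {K'} {suc x} x<K'))
                    (P.trans (P.sym (NP.+-assoc N x (suc (K' ∸ suc x))))
                             (P.trans (P.cong (_+ℕ suc (K' ∸ suc x)) (NP.+-comm N x)) (NP.+-assoc x N _))))

      -- A last layer of length k leaves exactly the matrix of segDet N.
      maximal-last-layer : ∀ N r c → replaceCol0 (lastLayerColumn N K') (rotated N) r c ≈ seg (N +ℕ toℕ c) (toℕ r)
      maximal-last-layer N r fzero = reflexive (P.trans (P.cong (λ u → g u (K' +ℕ toℕ r) (toℕ r)) (NP.+-comm N K'))
        (P.trans (genI-shift w K K' N (toℕ r) (toℕ r)) (P.cong (λ u → seg u (toℕ r)) (P.sym (NP.+-identityʳ N)))))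
      maximal-last-layer N r (fsuc c) = refl

      -- Rotate the new last column to the front, expand it by the last-layer
      -- recursion and use linearity: only the maximal last layer survives.
      segDet-step : ∀ N → segDet (suc N) ≈ sgn K' * (a K N * segDet N)
      segDet-step N = begin
          segDet (suc N)
        ≈⟨ det-cong K (λ s t → reflexive (P.cong (λ u → seg u (toℕ s)) (P.sym (NP.+-suc N (toℕ t))))) ⟩
          det K (λ s t → seg (N +ℕ suc (toℕ t)) (toℕ s))
        ≈⟨ det-rotate-columns K' (λ u s → seg (N +ℕ u) (toℕ s)) ⟩
          sgn K' * det K (rotated N)
        ≈⟨ *-cong refl (det-linear-col0 K' (rotated N) K coeff (lastLayerColumn N) (rotated-first-column N)) ⟩
          sgn K' * Σ< K (λ x → coeff x * det K (replaceCol0 (lastLayerColumn N x) (rotated N)))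
        ≈⟨ *-cong refl (Σ<-last K' (λ x → coeff x * det K (replaceCol0 (lastLayerColumn N x) (rotated N)))) ⟩
          sgn K' * (Σ< K' (λ x → coeff x * det K (replaceCol0 (lastLayerColumn N x) (rotated N)))
                    + coeff K' * det K (replaceCol0 (lastLayerColumn N K') (rotated N)))
        ≈⟨ *-cong refl (trans (+-cong (Σ<-zero K' (λ x x<K' → trans (*-cong refl (repeated-column N x x<K')) (zeroʳ _))) refl) (+-identityˡ _)) ⟩
          sgn K' * (coeff K' * det K (replaceCol0 (lastLayerColumn N K') (rotated N)))
        ≈⟨ *-cong refl (*-cong (reflexive (P.cong (a K) (NP.m+n∸n≡m N K'))) (det-cong K (maximal-last-layer N))) ⟩
          sgn K' * (a K N * segDet N) ∎
        where
        coeff : ℕ → Carrier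
        coeff x = a (suc x) ((N +ℕ K') ∸ x)

      segDet-value : ℕ → Carrier
      segDet-value N = sgn (K' *ℕ N) * (pow (w K) N * pow q (K' *ℕ (N C 2) +ℕ (K C 2) *ℕ N))

      segDet-closed : ∀ N → segDet N ≈ segDet-value N
      segDet-closed zero = trans (det-unitriangular K 0) (sym (trans (*-cong (reflexive (P.cong sgn (NP.*-zeroʳ K')))
        (trans (*-identityˡ _) (pow-cong q (P.trans (P.cong (K' *ℕ 0 +ℕ_) (NP.*-zeroʳ (K C 2))) (P.trans (NP.+-identityʳ _) (NP.*-zeroʳ K'))))))
        (*-identityˡ _)))
      segDet-closed (suc N) = begin
          segDet (suc N)
        ≈⟨ segDet-step N ⟩
          sgn K' * (a K N * segDet N)
        ≈⟨ *-cong refl (*-cong refl (segDet-closed N)) ⟩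
          sgn K' * ((w K * pow q eLayer) * (sgn (K' *ℕ N) * (pow (w K) N * pow q eOld)))
        ≈⟨ regroup (sgn K') (w K) (pow q eLayer) (sgn (K' *ℕ N)) (pow (w K) N) (pow q eOld) ⟩
          (sgn K' * sgn (K' *ℕ N)) * ((w K * pow (w K) N) * (pow q eLayer * pow q eOld))
        ≈⟨ *-cong (sym (trans (reflexive (P.cong sgn (NP.*-suc K' N))) (sgn-+ K' (K' *ℕ N))))
                  (*-cong refl (sym (trans (pow-cong q (ExponentArithmetic.det-exponent-step K' N (K C 2))) (pow-+ q eLayer eOld)))) ⟩
          segDet-value (suc N) ∎
        where
        eLayer = K' *ℕ N +ℕ K C 2
        eOld = K' *ℕ (N C 2) +ℕ (K C 2) *ℕ N
        regroup : ∀ s w pA t pw pE → s * ((w * pA) * (t * (pw * pE))) ≈ (s * t) * ((w * pw) * (pA * pE))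
        regroup = solve 6 (λ s w pA t pw pE → s :* ((w :* pA) :* (t :* (pw :* pE))) := (s :* t) :* ((w :* pw) :* (pA :* pE))) refl

  module Statements (K' : ℕ) where
    k : ℕ
    k = suc K'

    k-odd : k % 2 ≡ 1 → K' ≡ (k / 2) *ℕ 2
    k-odd odd = NP.suc-injective (P.trans (m≡m%n+[m/n]*n k 2) (P.cong (_+ℕ (k / 2) *ℕ 2) odd))

    k-even : k % 2 ≡ 0 → k ≡ (k / 2) *ℕ 2
    k-even even = P.trans (m≡m%n+[m/n]*n k 2) (P.cong (_+ℕ (k / 2) *ℕ 2) even)

    sgn-odd : ∀ N → k % 2 ≡ 1 → sgn (K' *ℕ N) ≈ 1#
    sgn-odd N odd = trans (reflexive (P.cong sgn (P.trans (P.cong (_*ℕ N) (k-odd odd)) (ExponentArithmetic.even-swap (k / 2) N))))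
                          (sgn-even (k / 2 *ℕ N))

    sgn-even-k : ∀ n' → k % 2 ≡ 0 → sgn (K' *ℕ (n' +ℕ k)) ≈ sgn n'
    sgn-even-k n' even = go (k / 2) (k-even even)
      where
      N = n' +ℕ k
      go : ∀ h → k ≡ h *ℕ 2 → sgn (K' *ℕ N) ≈ sgn n'
      go (suc h') k≡ = begin
          sgn (K' *ℕ N)
        ≡⟨ P.cong (λ u → sgn (u *ℕ N)) (NP.suc-injective k≡) ⟩
          sgn (N +ℕ (h' *ℕ 2) *ℕ N)
        ≈⟨ sgn-+ N ((h' *ℕ 2) *ℕ N) ⟩
          sgn N * sgn ((h' *ℕ 2) *ℕ N)
        ≈⟨ *-cong (sgn-+ n' k) (trans (reflexive (P.cong sgn (ExponentArithmetic.even-swap h' N))) (sgn-even (h' *ℕ N))) ⟩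
          (sgn n' * sgn k) * 1#
        ≈⟨ trans (*-identityʳ _) (trans (*-cong refl (trans (reflexive (P.cong sgn k≡)) (sgn-even (suc h')))) (*-identityʳ _)) ⟩
          sgn n' ∎

    module _ (q : Carrier) where
      open Weights q

      Fℤ-⊖ : ∀ w a b → Fℤ k (a ⊖ b) w q ≈ genI w k a b 0
      Fℤ-⊖ w a zero = refl
      Fℤ-⊖ w zero (suc b) = refl
      Fℤ-⊖ w (suc a) (suc b) = trans (reflexive (P.cong (λ t → Fℤ k t w q) (ZP.[1+m]⊖[1+n]≡m⊖n a b))) (Fℤ-⊖ w a b)

      -- First statement: the cut identity for (0, m+n] cut at m.
      convolution : ∀ m n (z : ℕ → Carrier) → F k (m +ℕ n) z q ≈
        (F k m z q * F k n (E m q z) q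
         + sumL (range 2 k) (λ i → sumL (range 1 (i ∸ 1)) (λ j →
             z i * (pow q ((m ∸ j) *ℕ (i ∸ 1) +ℕ i C 2)
             * (Fℤ k (+ m -ℤ + j) z q
             * Fℤ k (+ n -ℤ + i +ℤ + j) (E (m +ℕ i ∸ j) q z) q)))))
      convolution m n z = begin
          seg (m +ℕ n) 0
        ≈⟨ cut m m 0 m (m +ℕ n) NP.≤-refl P.refl (NP.m≤m+n m n) ⟩
          seg m 0 * seg (m +ℕ n) m + straddle 0 m (m +ℕ n)
        ≈⟨ +-cong (*-cong refl right-part) straddling ⟩
          F k m z q * F k n (E m q z) q + sumL (range 2 k) termᵢ ∎
        where
        open Segments z K'
        termᵢⱼ : ℕ → ℕ → Carrier
        termᵢⱼ i j = z i * (pow q ((m ∸ j) *ℕ (i ∸ 1) +ℕ i C 2) * (Fℤ k (+ m -ℤ + j) z q * Fℤ k (+ n -ℤ + i +ℤ + j) (E (m +ℕ i ∸ j) q z) q))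
        termᵢ : ℕ → Carrier
        termᵢ i = sumL (range 1 (i ∸ 1)) (termᵢⱼ i)
        right-part : seg (m +ℕ n) m ≈ F k n (E m q z) q
        right-part = trans (reflexive (P.trans (P.cong (λ u → g (m +ℕ n) u m) (P.sym (NP.+-identityʳ m))) (genI-shift z k m n 0 m)))
                           (sym (gen-E z k n m 0))
        straddling-term : ∀ y j' → straddleTerm 0 m (m +ℕ n) y j' ≈ termᵢⱼ (suc (suc y)) (suc j')
        straddling-term y j' = trans (*-assoc _ _ _)
          (*-cong refl (*-cong (pow-cong q (P.cong (_+ℕ i C 2) (NP.*-comm (i ∸ 1) (m ∸ j)))) (*-cong left right)))
          where
          i = suc (suc y)
          j = suc j'
          p = (m +ℕ i) ∸ j
          left : g m (j +ℕ 0) 0 ≈ Fℤ k (+ m -ℤ + j) z q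
          left = trans (reflexive (P.cong (λ u → g m u 0) (NP.+-identityʳ j)))
                       (trans (sym (Fℤ-⊖ z m j)) (reflexive (P.cong (λ t → Fℤ k t z q) (P.sym (ZP.m-n≡m⊖n m j)))))
          right : g ((m +ℕ n) +ℕ j) (m +ℕ i) p ≈ Fℤ k (+ n -ℤ + i +ℤ + j) (E p q z) q
          right = trans (reflexive (P.trans (P.cong (λ u → g u (m +ℕ i) p) (NP.+-assoc m n j)) (genI-shift z k m (n +ℕ j) i p)))
                    (trans (sym (genI-E z k (n +ℕ j) i p 0))
                      (trans (sym (Fℤ-⊖ (E p q z) (n +ℕ j) i))
                        (reflexive (P.cong (λ t → Fℤ k t (E p q z) q)
                          (P.sym (P.trans (P.cong (_+ℤ + j) (ZP.m-n≡m⊖n n i)) (ZP.distribˡ-⊖-+-pos j n i)))))))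
        straddling : straddle 0 m (m +ℕ n) ≈ sumL (range 2 k) termᵢ
        straddling = begin
            Σ< K' (λ y → Σ< (suc y) (λ j' → straddleTerm 0 m (m +ℕ n) y j'))
          ≈⟨ Σ<-cong K' (λ y → Σ<-cong (suc y) (straddling-term y)) ⟩
            Σ< K' (λ y → Σ< (suc y) (λ j' → termᵢⱼ (suc (suc y)) (suc j')))
          ≈⟨ Σ<-cong K' (λ y → reflexive (P.sym (P.trans (Σl-map suc (upTo (suc y)) (termᵢⱼ (suc (suc y)))) (Σl-applyUpTo (λ x → x) (suc y) _)))) ⟩
            Σ< K' (λ y → termᵢ (suc (suc y)))
          ≡⟨ P.sym (P.trans (Σl-map (2 +ℕ_) (upTo K') termᵢ) (Σl-applyUpTo (λ x → x) K' _)) ⟩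
            sumL (range 2 k) termᵢ ∎

      -- Second statement: decomposition by the first layer of length k.
      recursion : ∀ n (z : ℕ → Carrier) → F k n z q ≈
        (F (k ∸ 1) n z q
         + sumL (upTo (suc n ∸ k)) (λ j →
             z k * (pow q (j *ℕ (k ∸ 1) +ℕ k C 2)
             * (F (k ∸ 1) j z q * F k (n ∸ k ∸ j) (E (k +ℕ j) q z) q))))
      recursion n z = begin
          seg n 0
        ≈⟨ first-max-layer n n 0 n NP.≤-refl P.refl ⟩
          g' n 0 0 + Σ< (suc n) (λ j → a K (0 +ℕ j) * (gen' j 0 * afterMax n 0 j))
        ≈⟨ +-cong refl (trans (Σ<-truncate (suc n) (suc n ∸ k) _ (NP.m∸n≤m (suc n) k) too-long)
              (trans (Σ<-cong-below (suc n ∸ k) in-range) (reflexive (P.sym (Σl-applyUpTo (λ x → x) (suc n ∸ k) termⱼ))))) ⟩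
          F (k ∸ 1) n z q + sumL (upTo (suc n ∸ k)) termⱼ ∎
        where
        open Segments z K' using (seg; a; K)
        open FirstMaximalLayer z K'
        termⱼ : ℕ → Carrier
        termⱼ j = z k * (pow q (j *ℕ (k ∸ 1) +ℕ k C 2) * (F (k ∸ 1) j z q * F k (n ∸ k ∸ j) (E (k +ℕ j) q z) q))
        too-long : ∀ i → suc n ∸ k ≤ i → i < suc n → a K (0 +ℕ i) * (gen' i 0 * afterMax n 0 i) ≈ 0#
        too-long i n+1-k≤i _ = trans (*-cong refl (trans (*-cong refl (reflexive (genI-< z K n (K +ℕ i) (K +ℕ i) n<k+i))) (zeroʳ _))) (zeroʳ _)
          where n<k+i : n < K +ℕ i
                n<k+i = NP.≤-trans (NP.m≤n+m∸n (suc n) K) (NP.+-monoʳ-≤ K n+1-k≤i)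
        in-range : ∀ i → i < suc n ∸ k → a K (0 +ℕ i) * (gen' i 0 * afterMax n 0 i) ≈ termⱼ i
        in-range i i<n+1-k = trans (*-assoc _ _ _)
          (*-cong refl (*-cong (pow-cong q (P.cong (_+ℕ k C 2) (NP.*-comm K' i))) (*-cong refl after-layer)))
          where
          k+i≤n : K +ℕ i ≤ n
          k+i≤n = NP.≤-pred (P.subst (suc (K +ℕ i) ≤_) (NP.m+[n∸m]≡n k≤n+1)
                                     (P.subst (_≤ K +ℕ (suc n ∸ K)) (NP.+-suc K i) (NP.+-monoʳ-≤ K i<n+1-k)))
            where k≤n+1 : K ≤ suc n
                  k≤n+1 = NP.≮⇒≥ (λ n+1<k → NP.n≮0 (P.subst (i <_) (NP.m≤n⇒m∸n≡0 (NP.<⇒≤ n+1<k)) i<n+1-k))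
          after-layer : afterMax n 0 i ≈ F k (n ∸ k ∸ i) (E (k +ℕ i) q z) q
          after-layer = trans (reflexive (P.trans (genI-≤ z K n (K +ℕ i) (K +ℕ i) k+i≤n)
                                                  (P.cong (λ u → gen z K u (K +ℕ i)) (P.sym (NP.∸-+-assoc n K i)))))
                              (sym (gen-E z K (n ∸ k ∸ i) (K +ℕ i) 0))

      -- Third statement: the determinant of shifted F's is segDet (n+K').
      determinant : ∀ n → 1 ≤ n → (z : ℕ → Carrier) →
          (k % 2 ≡ 1 → det k (λ s t → F k ((n +ℕ k ∸ 1 +ℕ toℕ t) ∸ toℕ s) (E (toℕ s) q z) q)
                   ≈ pow (z k) (n +ℕ k ∸ 1) * pow q ((k ∸ 1) *ℕ ((n +ℕ k ∸ 1) C 2) +ℕ (k C 2) *ℕ (n +ℕ k ∸ 1)))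
        × (k % 2 ≡ 0 → det k (λ s t → F k ((n +ℕ k ∸ 1 +ℕ toℕ t) ∸ toℕ s) (E (toℕ s) q z) q)
                   ≈ sgn (n ∸ 1) * (pow (z k) (n +ℕ k ∸ 1) * pow q ((k ∸ 1) *ℕ ((n +ℕ k ∸ 1) C 2) +ℕ (k C 2) *ℕ (n +ℕ k ∸ 1))))
      determinant (suc n') _ z = (λ odd → trans value (trans (*-cong (sgn-odd N odd) refl) (*-identityˡ _)))
                               , (λ even → trans value (*-cong (sgn-even-k n' even) refl))
        where
        open SegmentDeterminant z K'
        N = n' +ℕ k
        as-segDet : det k (λ s t → F k ((N +ℕ toℕ t) ∸ toℕ s) (E (toℕ s) q z) q) ≈ segDet N
        as-segDet = det-cong k (λ s t → trans (gen-E z k ((N +ℕ toℕ t) ∸ toℕ s) (toℕ s) 0)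
          (reflexive (P.sym (genI-≤ z k (N +ℕ toℕ t) (toℕ s) (toℕ s)
            (NP.≤-trans (NP.≤-pred (toℕ<n s)) (NP.≤-trans (NP.≤-trans (NP.n≤1+n K') (NP.m≤n+m k n')) (NP.m≤m+n N (toℕ t))))))))
        value : det k (λ s t → F k ((N +ℕ toℕ t) ∸ toℕ s) (E (toℕ s) q z) q) ≈ segDet-value N
        value = trans as-segDet (segDet-closed N)

mainTheorem15 : ∀ {c ℓ} (R : CommutativeRing c ℓ) (k : ℕ) → 1 ≤ k →
    let open CommutativeRing R
        open Poly R
    in ((m n : ℕ) → 1 ≤ m → 1 ≤ n → (z : ℕ → Carrier) (q : Carrier) →
          F k (m +ℕ n) z q ≈
            (F k m z q * F k n (E m q z) q
             + sumL (range 2 k) (λ i → sumL (range 1 (i ∸ 1)) (λ j →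
                 z i * (pow q ((m ∸ j) *ℕ (i ∸ 1) +ℕ i C 2)
                 * (Fℤ k (+ m -ℤ + j) z q
                 * Fℤ k (+ n -ℤ + i +ℤ + j) (E (m +ℕ i ∸ j) q z) q))))))
     × ((n : ℕ) → 1 ≤ n → (z : ℕ → Carrier) (q : Carrier) →
          F k n z q ≈
            (F (k ∸ 1) n z q
             + sumL (upTo (suc n ∸ k)) (λ j →
                 z k * (pow q (j *ℕ (k ∸ 1) +ℕ k C 2)
                 * (F (k ∸ 1) j z q * F k (n ∸ k ∸ j) (E (k +ℕ j) q z) q)))))
     × ((n : ℕ) → 1 ≤ n → (z : ℕ → Carrier) (q : Carrier) →
          (k % 2 ≡ 1 → det k (λ s t → F k ((n +ℕ k ∸ 1 +ℕ toℕ t) ∸ toℕ s) (E (toℕ s) q z) q)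
                   ≈ pow (z k) (n +ℕ k ∸ 1) * pow q ((k ∸ 1) *ℕ ((n +ℕ k ∸ 1) C 2) +ℕ (k C 2) *ℕ (n +ℕ k ∸ 1)))
        × (k % 2 ≡ 0 → det k (λ s t → F k ((n +ℕ k ∸ 1 +ℕ toℕ t) ∸ toℕ s) (E (toℕ s) q z) q)
                   ≈ sgn (n ∸ 1) * (pow (z k) (n +ℕ k ∸ 1) * pow q ((k ∸ 1) *ℕ ((n +ℕ k ∸ 1) C 2) +ℕ (k C 2) *ℕ (n +ℕ k ∸ 1)))))
mainTheorem15 R (suc K') _ =
    (λ m n _ _ z q → convolution q m n z)
  , (λ n _ z q → recursion q n z)
  , (λ n 1≤n z q → determinant q n 1≤n z)
  where open WithRing.Statements R K'
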